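{- For the sink function $\mathsf{SINK}:\{0,1\}^{\binom k2}\to\{0,1\}$ and the Rubinstein function $\mathsf{RUB}:\{0,1\}^{k^2}\to\{0,1\}$, (1) $\widetilde{\deg}(\mathsf{SINK})=O(\sqrt k\log k)$, and (2) $\widetilde{\deg}(\mathsf{RUB})=O(k\log k)$.
   Context: $\widetilde{\deg}(h)$ is the minimum degree of a real polynomial $p$ with $|p(x)-h(x)|\le 1/3$ for all Boolean inputs $x$. $\mathsf{SINK}$: the $\binom k2$ input variables $x_{ij}$ ($i<j$) encode a tournament on vertex set $[k]$, where $x_{ij}=1$ means the edge between $i$ and $j$ is directed from $i$ to $j$ (and $x_{ij}=0$ means from $j$ to $i$). A vertex is a sink if all edges incident to it are incoming; $\mathsf{SINK}(x)=1$ iff the tournament has a sink vertex. $\mathsf{RUB}=\mathsf{OR}_k\circ g$ where $g:\{0,1\}^k\to\{0,1\}$ has $g(y)=1$ iff $y$ contains exactly two ones and they are in consecutive positions, and $(\mathsf{OR}_k\circ g)(y_1,\dots,y_k)=\mathsf{OR}(g(y_1),\dots,g(y_k))$. -}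

module Defs where

open import Data.Bool using (Bool; true; false; not; _∧_; if_then_else_)
open import Data.Nat as ℕ using (ℕ; _⊔_; _≡ᵇ_)
open import Data.Fin using (Fin; toℕ; _<_; _<?_)
open import Data.Fin.Properties using (_≟_)
open import Data.List using (List; []; _∷_; length; foldr; allFin; map)
open import Data.Bool.ListAction using (all; any)
open import Data.Nat.ListAction using (sum)
open import Data.Integer using (+_)
open import Data.Product using (Σ; _×_; _,_; ∃)
open import Data.Rational as ℚ using (ℚ; 0ℚ; 1ℚ; _*_; _+_; _-_; ∣_∣; _≤_; _/_)
open import Relation.Nullary using (yes; no)

-- Real polynomials (coefficients in ℚ) in variables indexed by a type V.
-- A monomial is a coefficient together with the multiset (list) of its variables;
-- its degree is the number of variables (with multiplicity).
Monomial : Set → Set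
Monomial V = ℚ × List V

Poly : Set → Set
Poly V = List (Monomial V)

boolToℚ : Bool → ℚ
boolToℚ true  = 1ℚ
boolToℚ false = 0ℚ

evalMon : {V : Set} → (V → Bool) → Monomial V → ℚ
evalMon x (c , vs) = c * foldr (λ v r → boolToℚ (x v) * r) 1ℚ vs

eval : {V : Set} → Poly V → (V → Bool) → ℚ
eval p x = foldr (λ m r → evalMon x m + r) 0ℚ p

degree : {V : Set} → Poly V → ℕ
degree p = foldr (λ m r → length (Data.Product.proj₂ m) ⊔ r) 0 p

Approximates : {V : Set} → Poly V → ((V → Bool) → Bool) → Set
Approximates p h = ∀ x → ∣ eval p x - boolToℚ (h x) ∣ ≤ (+ 1) / 3

ApproxDeg≤ : {V : Set} → ((V → Bool) → Bool) → ℕ → Set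
ApproxDeg≤ {V} h d = Σ (Poly V) λ p → (degree p ℕ.≤ d) × Approximates p h

-- SINK: variables x_ij for i < j in [k]; x_ij = true means edge i → j.

SinkVar : ℕ → Set
SinkVar k = Σ (Fin k × Fin k) λ { (i , j) → i < j }

-- is the edge between u and v directed into v?  (true when u = v)
incoming : {k : ℕ} → (SinkVar k → Bool) → Fin k → Fin k → Bool
incoming x u v with u <? v | v <? u
... | yes u<v | _       = x ((u , v) , u<v)
... | no _    | yes v<u = not (x ((v , u) , v<u))
... | no _    | no _    = true

isSink : {k : ℕ} → (SinkVar k → Bool) → Fin k → Bool
isSink {k} x v = all (λ u → incoming x u v) (allFin k)

SINK : (k : ℕ) → (SinkVar k → Bool) → Bool
SINK k x = any (isSink x) (allFin k)

-- RUB = OR_k ∘ g on k² variables y (i , j) = j-th bit of block y_i.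

countOnes : {k : ℕ} → (Fin k → Bool) → ℕ
countOnes {k} y = sum (map (λ i → if y i then 1 else 0) (allFin k))

g : (k : ℕ) → (Fin k → Bool) → Bool
g k y = (countOnes y ≡ᵇ 2)
      ∧ any (λ i → any (λ j → (toℕ j ≡ᵇ ℕ.suc (toℕ i)) ∧ y i ∧ y j) (allFin k)) (allFin k)

RUB : (k : ℕ) → (Fin k × Fin k → Bool) → Bool
RUB k y = any (λ i → g k (λ j → y (i , j))) (allFin k)

-- The approximating polynomials are built from Chebyshev polynomials. For a count t ∈ {0, …, n}
-- of true literals, T_m(-1 + 2(t + 1)/n)² is at most 1 for t < n, but at least 9 at t = n once
-- m² ≥ n, since T_m grows like 1 + m² δ just right of 1. Normalising and raising to the power p
-- gives an approximate AND of n literals of degree 2mp, exact at t = n and at most 4⁻ᵖ below.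
-- SINK is the OR over vertices v of "every edge points into v", and at most one vertex is a sink,
-- so summing these ANDs approximates SINK within k 4⁻ᵖ; m ≈ √k and p ≈ log k give degree
-- O(√k log k). Likewise g is the OR over positions j of "the block is the indicator of
-- {j, j + 1}", with at most one matching j, so summing over blocks gives Z within 1/32 of the
-- number s of blocks on which g holds. A second Chebyshev step T_M(1 + r - r Z) with M ≈ √k and
-- r = 1/(32k) stays in [-1, 1] when s ≥ 1 and exceeds 1 by a constant factor when s = 0, so a
-- constant power of its square separates the two cases, at degree O(√k) · O(√k log k).

module Submission where

open import Defs
open import Data.Nat as ℕ using (ℕ; suc)

module Rationals where

  open import Algebra.Bundles using (CommutativeRing)
  open import Data.Nat as ℕ using (ℕ; zero; suc)
  open import Data.Rational
    using (ℚ; 0ℚ; 1ℚ; _+_; _*_; _-_; -_; _≤_; _<_; ∣_∣; _/_; 1/_; positive; nonNegative)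
  open import Data.Integer using (+_)
  open import Data.Rational.Properties
  open import Data.Sum using (inj₁; inj₂)
  open import Data.List using (List; []; _∷_; foldr)
  open import Relation.Binary.PropositionalEquality
  open import Relation.Nullary.Decidable using (dec⇒maybe)
  open import Tactic.RingSolver using (solve-∀; solve)
  open import Tactic.RingSolver.Core.AlmostCommutativeRing
    using (AlmostCommutativeRing; fromCommutativeRing)

  ℚ-ring : AlmostCommutativeRing _ _
  ℚ-ring = fromCommutativeRing +-*-commutativeRing (λ x → dec⇒maybe (0ℚ ≟ x))

  open import Algebra.Properties.Semiring.Mult (CommutativeRing.semiring +-*-commutativeRing)
    using (_×_; ×-homo-+; ×1-homo-*)
  open import Algebra.Properties.CommutativeSemiring.Exp
    (CommutativeRing.commutativeSemiring +-*-commutativeRing)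
    using (_^_; ^-distrib-*) public

  ∑ : {A : Set} → (A → ℚ) → List A → ℚ
  ∑ f = foldr (λ a r → f a + r) 0ℚ

  fromℕ : ℕ → ℚ
  fromℕ n = n × 1ℚ

  ¼ : ℚ
  ¼ = + 1 / 4

  fromℕ-+ : ∀ m n → fromℕ (m ℕ.+ n) ≡ fromℕ m + fromℕ n
  fromℕ-+ = ×-homo-+ 1ℚ

  fromℕ-* : ∀ m n → fromℕ (m ℕ.* n) ≡ fromℕ m * fromℕ n
  fromℕ-* = ×1-homo-*

  +-nonNeg : ∀ {a b} → 0ℚ ≤ a → 0ℚ ≤ b → 0ℚ ≤ a + b
  +-nonNeg {a} {b} p q = subst (_≤ a + b) (+-identityˡ 0ℚ) (+-mono-≤ p q)

  *-nonNeg : ∀ {a b} → 0ℚ ≤ a → 0ℚ ≤ b → 0ℚ ≤ a * b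
  *-nonNeg {a} {b} p q =
    nonNegative⁻¹ (a * b) {{nonNeg*nonNeg⇒nonNeg a {{nonNegative p}} b {{nonNegative q}}}}

  0≤1 : 0ℚ ≤ 1ℚ
  0≤1 = ≤ᵇ⇒≤ _

  -- Most inequalities below are proved by exhibiting b - a as a manifestly nonnegative
  -- expression, the identity being checked by the ring solver.
  ≤-by-difference : ∀ {a b} s → 0ℚ ≤ s → b - a ≡ s → a ≤ b
  ≤-by-difference {a} {b} s 0≤s b-a≡s = begin
      a             ≡⟨ sym (+-identityˡ a) ⟩
      0ℚ + a        ≤⟨ +-monoˡ-≤ a 0≤s ⟩
      s + a         ≡⟨ cong (_+ a) (sym b-a≡s) ⟩
      b - a + a     ≡⟨ solve (a ∷ b ∷ []) ℚ-ring ⟩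
      b             ∎
    where open ≤-Reasoning

  0≤-difference : ∀ {a b} → a ≤ b → 0ℚ ≤ b - a
  0≤-difference {a} {b} a≤b = subst (_≤ b - a) (+-inverseʳ a) (+-monoˡ-≤ (- a) a≤b)

  0≤square : ∀ a → 0ℚ ≤ a * a
  0≤square a with ≤-total 0ℚ a
  ... | inj₁ 0≤a = *-nonNeg 0≤a 0≤a
  ... | inj₂ a≤0 = subst (0ℚ ≤_) (square-neg a) (*-nonNeg (0≤-difference a≤0) (0≤-difference a≤0))
    where
      square-neg : ∀ a → (0ℚ - a) * (0ℚ - a) ≡ a * a
      square-neg = solve-∀ ℚ-ring

  *-mono-≤-nonNeg : ∀ {a b c d} → 0ℚ ≤ a → a ≤ b → 0ℚ ≤ c → c ≤ d → a * c ≤ b * d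
  *-mono-≤-nonNeg {a} {b} {c} {d} 0≤a a≤b 0≤c c≤d = ≤-trans
    (*-monoʳ-≤-nonNeg c {{nonNegative 0≤c}} a≤b)
    (*-monoˡ-≤-nonNeg b {{nonNegative (≤-trans 0≤a a≤b)}} c≤d)

  square-mono-≤ : ∀ {a b} → 0ℚ ≤ a → a ≤ b → a * a ≤ b * b
  square-mono-≤ 0≤a a≤b = *-mono-≤-nonNeg 0≤a a≤b 0≤a a≤b

  ∣∣-≤ : ∀ {z r} → - r ≤ z → z ≤ r → ∣ z ∣ ≤ r
  ∣∣-≤ {z} {r} -r≤z z≤r with ∣p∣≡p∨∣p∣≡-p z
  ... | inj₁ ∣z∣≡z  = subst (_≤ r) (sym ∣z∣≡z) z≤r
  ... | inj₂ ∣z∣≡-z = subst (_≤ r) (sym ∣z∣≡-z) (subst (- z ≤_) (neg-neg r) (neg-antimono-≤ -r≤z))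
    where
      neg-neg : ∀ r → - (- r) ≡ r
      neg-neg = solve-∀ ℚ-ring

  p≤p+q : ∀ {p q} → 0ℚ ≤ q → p ≤ p + q
  p≤p+q {p} {q} 0≤q = subst (_≤ p + q) (+-identityʳ p) (+-monoʳ-≤ p 0≤q)

  sandwich⇒∣-∣≤ : ∀ {p q δ r} → q ≤ p → p ≤ q + δ → δ ≤ r → ∣ p - q ∣ ≤ r
  sandwich⇒∣-∣≤ {p} {q} {δ} {r} q≤p p≤q+δ δ≤r = ∣∣-≤ (≤-trans (neg-antimono-≤ 0≤r) 0≤p-q) p-q≤r
    where
      shift : ∀ p q δ → δ - (p - q) ≡ q + δ - p
      shift = solve-∀ ℚ-ring
      0≤p-q : 0ℚ ≤ p - q
      0≤p-q = 0≤-difference q≤p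
      p-q≤r : p - q ≤ r
      p-q≤r = ≤-trans (≤-by-difference (q + δ - p) (0≤-difference p≤q+δ) (shift p q δ)) δ≤r
      0≤r : 0ℚ ≤ r
      0≤r = ≤-trans 0≤p-q p-q≤r

  fromℕ-nonNeg : ∀ n → 0ℚ ≤ fromℕ n
  fromℕ-nonNeg zero    = ≤-refl
  fromℕ-nonNeg (suc n) = +-nonNeg 0≤1 (fromℕ-nonNeg n)

  fromℕ-mono-≤ : ∀ {m n} → m ℕ.≤ n → fromℕ m ≤ fromℕ n
  fromℕ-mono-≤ {n = n} ℕ.z≤n = fromℕ-nonNeg n
  fromℕ-mono-≤ (ℕ.s≤s m≤n)   = +-monoʳ-≤ 1ℚ (fromℕ-mono-≤ m≤n)

  fromℕ-pos : ∀ {n} → 1 ℕ.≤ n → 0ℚ < fromℕ n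
  fromℕ-pos {suc n} _ = <-≤-trans (positive⁻¹ 1ℚ) (+-monoʳ-≤ 1ℚ (fromℕ-nonNeg n))

  reciprocal : (y : ℚ) → 0ℚ < y → ℚ
  reciprocal y 0<y = (1/ y) {{pos⇒nonZero y {{positive 0<y}}}}

  reciprocal-inverseˡ : ∀ y 0<y → reciprocal y 0<y * y ≡ 1ℚ
  reciprocal-inverseˡ y 0<y = *-inverseˡ y {{pos⇒nonZero y {{positive 0<y}}}}

  reciprocal-nonNeg : ∀ y 0<y → 0ℚ ≤ reciprocal y 0<y
  reciprocal-nonNeg y 0<y = <⇒≤ (positive⁻¹ _ {{1/pos⇒pos y {{positive 0<y}}}})

  inverse-antitone : ∀ {c y a b} → 0ℚ ≤ c → c * y ≡ 1ℚ → a ≤ y → 0ℚ ≤ b → a * b ≡ 1ℚ → c ≤ b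
  inverse-antitone {c} {y} {a} {b} 0≤c cy≡1 a≤y 0≤b ab≡1 = begin
      c             ≡⟨ sym (trans (cong (c *_) ab≡1) (*-identityʳ c)) ⟩
      c * (a * b)   ≤⟨ *-monoˡ-≤-nonNeg c {{nonNegative 0≤c}} (*-monoʳ-≤-nonNeg b {{nonNegative 0≤b}} a≤y) ⟩
      c * (y * b)   ≡⟨ sym (*-assoc c y b) ⟩
      c * y * b     ≡⟨ cong (_* b) cy≡1 ⟩
      1ℚ * b        ≡⟨ *-identityˡ b ⟩
      b             ∎
    where open ≤-Reasoning

  ^-nonNeg : ∀ {a} n → 0ℚ ≤ a → 0ℚ ≤ a ^ n
  ^-nonNeg zero    0≤a = 0≤1
  ^-nonNeg (suc n) 0≤a = *-nonNeg 0≤a (^-nonNeg n 0≤a)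

  ^-monoˡ-≤ : ∀ {a b} n → 0ℚ ≤ a → a ≤ b → a ^ n ≤ b ^ n
  ^-monoˡ-≤ zero    0≤a a≤b = ≤-refl
  ^-monoˡ-≤ (suc n) 0≤a a≤b = *-mono-≤-nonNeg 0≤a a≤b (^-nonNeg n 0≤a) (^-monoˡ-≤ n 0≤a a≤b)

  1^n≡1 : ∀ n → 1ℚ ^ n ≡ 1ℚ
  1^n≡1 zero    = refl
  1^n≡1 (suc n) = trans (*-identityˡ _) (1^n≡1 n)

  bernoulli : ∀ {w} n → 0ℚ ≤ w → 1ℚ + fromℕ n * w ≤ (1ℚ + w) ^ n
  bernoulli {w} zero 0≤w = ≤-reflexive (base w)
    where
      base : ∀ w → 1ℚ + 0ℚ * w ≡ 1ℚ
      base = solve-∀ ℚ-ring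
  bernoulli {w} (suc n) 0≤w = ≤-trans
    (≤-by-difference (fromℕ n * w * w) (*-nonNeg (*-nonNeg (fromℕ-nonNeg n) 0≤w) 0≤w)
      (step w (fromℕ n)))
    (*-monoˡ-≤-nonNeg (1ℚ + w) {{nonNegative (+-nonNeg 0≤1 0≤w)}} (bernoulli n 0≤w))
    where
      step : ∀ w m → (1ℚ + w) * (1ℚ + m * w) - (1ℚ + (1ℚ + m) * w) ≡ m * w * w
      step = solve-∀ ℚ-ring

  -- The reverse Bernoulli bound (1 + y)ⁿ ≤ 1 / (1 - n y), multiplied out.
  bernoulli-reverse : ∀ {y} n → 0ℚ ≤ y → (1ℚ + y) ^ n * (1ℚ - fromℕ n * y) ≤ 1ℚ
  bernoulli-reverse {y} zero 0≤y = ≤-reflexive (base y)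
    where
      base : ∀ y → 1ℚ * (1ℚ - 0ℚ * y) ≡ 1ℚ
      base = solve-∀ ℚ-ring
  bernoulli-reverse {y} (suc n) 0≤y = ≤-trans
    (≤-by-difference ((1ℚ + y) ^ n * (fromℕ (suc n) * y * y))
      (*-nonNeg (^-nonNeg n (+-nonNeg 0≤1 0≤y)) (*-nonNeg (*-nonNeg (fromℕ-nonNeg (suc n)) 0≤y) 0≤y))
      (step y (fromℕ n) ((1ℚ + y) ^ n)))
    (bernoulli-reverse n 0≤y)
    where
      step : ∀ y m p → p * (1ℚ - m * y) - (1ℚ + y) * p * (1ℚ - (1ℚ + m) * y) ≡ p * ((1ℚ + m) * y * y)
      step = solve-∀ ℚ-ring


  fromℕ-^ : ∀ m p → fromℕ (m ℕ.^ p) ≡ fromℕ m ^ p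
  fromℕ-^ m zero    = refl
  fromℕ-^ m (suc p) = trans (fromℕ-* m (m ℕ.^ p)) (cong (fromℕ m *_) (fromℕ-^ m p))

  ≤4^⇒*¼^≤ : ∀ a n p {c} → a ℕ.* n ℕ.≤ 4 ℕ.^ p → c * fromℕ a ≡ 1ℚ → 0ℚ ≤ c → fromℕ n * ¼ ^ p ≤ c
  ≤4^⇒*¼^≤ a n p {c} an≤4ᵖ ca≡1 0≤c = begin
    fromℕ n * ¼ ^ p                   ≡⟨ cong (_* ¼ ^ p) n≡c·an ⟩
    c * fromℕ (a ℕ.* n) * ¼ ^ p       ≤⟨ *-monoʳ-≤-nonNeg (¼ ^ p) {{nonNegative (^-nonNeg p (≤ᵇ⇒≤ _))}}
                                           (*-monoˡ-≤-nonNeg c {{nonNegative 0≤c}} (fromℕ-mono-≤ an≤4ᵖ)) ⟩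
    c * fromℕ (4 ℕ.^ p) * ¼ ^ p       ≡⟨ cong (λ v → c * v * ¼ ^ p) (fromℕ-^ 4 p) ⟩
    c * fromℕ 4 ^ p * ¼ ^ p           ≡⟨ *-assoc c (fromℕ 4 ^ p) (¼ ^ p) ⟩
    c * (fromℕ 4 ^ p * ¼ ^ p)         ≡⟨ cong (c *_) (trans (sym (^-distrib-* (fromℕ 4) ¼ p)) (1^n≡1 p)) ⟩
    c * 1ℚ                            ≡⟨ *-identityʳ c ⟩
    c                                 ∎
    where
      open ≤-Reasoning
      n≡c·an : fromℕ n ≡ c * fromℕ (a ℕ.* n)
      n≡c·an = begin-equality
        fromℕ n                       ≡⟨ sym (*-identityˡ (fromℕ n)) ⟩
        1ℚ * fromℕ n                  ≡⟨ cong (_* fromℕ n) (sym ca≡1) ⟩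
        c * fromℕ a * fromℕ n         ≡⟨ *-assoc c (fromℕ a) (fromℕ n) ⟩
        c * (fromℕ a * fromℕ n)       ≡⟨ cong (c *_) (sym (fromℕ-* a n)) ⟩
        c * fromℕ (a ℕ.* n)           ∎


module Chebyshev where

  open Rationals
  open import Data.Nat as ℕ using (ℕ; zero; suc)
  import Data.Nat.Properties as ℕ
  open import Data.Rational using (ℚ; 0ℚ; 1ℚ; _+_; _*_; _-_; -_; _≤_; nonNegative)
  open import Data.Rational.Properties
  open import Data.Product using (_×_; _,_; proj₁; proj₂)
  open import Relation.Binary.PropositionalEquality using (_≡_; refl; trans; cong; module ≡-Reasoning)
  open import Tactic.RingSolver using (solve-∀)

  -- chebyshev x j = (T_{j+1}(x), U_j(x)), computed by the joint recurrence
  -- T_{j+2} = x T_{j+1} + (x² - 1) U_j,  U_{j+1} = T_{j+1} + x U_j.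
  chebyshev : ℚ → ℕ → ℚ × ℚ
  chebyshev x zero    = x , 1ℚ
  chebyshev x (suc j) = let (t , u) = chebyshev x j in x * t + (x * x - 1ℚ) * u , t + x * u

  chebyshevT chebyshevU : ℚ → ℕ → ℚ
  chebyshevT x j = proj₁ (chebyshev x j)
  chebyshevU x j = proj₂ (chebyshev x j)

  chebyshev-pell : ∀ x j →
    chebyshevT x j * chebyshevT x j - (x * x - 1ℚ) * (chebyshevU x j * chebyshevU x j) ≡ 1ℚ
  chebyshev-pell x zero    = base x
    where
      base : ∀ x → x * x - (x * x - 1ℚ) * (1ℚ * 1ℚ) ≡ 1ℚ
      base = solve-∀ ℚ-ring
  chebyshev-pell x (suc j) = trans (step x (chebyshevT x j) (chebyshevU x j)) (chebyshev-pell x j)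
    where
      step : ∀ x t u →
        (x * t + (x * x - 1ℚ) * u) * (x * t + (x * x - 1ℚ) * u) - (x * x - 1ℚ) * ((t + x * u) * (t + x * u))
          ≡ t * t - (x * x - 1ℚ) * (u * u)
      step = solve-∀ ℚ-ring

  chebyshevT²≤1 : ∀ {x} j → - 1ℚ ≤ x → x ≤ 1ℚ → chebyshevT x j * chebyshevT x j ≤ 1ℚ
  chebyshevT²≤1 {x} j -1≤x x≤1 =
    ≤-by-difference ((1ℚ - x) * (x - - 1ℚ) * (u * u))
      (*-nonNeg (*-nonNeg (0≤-difference x≤1) (0≤-difference -1≤x)) (0≤square u))
      (begin
        1ℚ - t * t                                              ≡⟨ by-pell x t u ⟩
        D + (1ℚ - (t * t - (x * x - 1ℚ) * (u * u)))              ≡⟨ cong (λ z → D + (1ℚ - z)) (chebyshev-pell x j) ⟩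
        D + 0ℚ                                                  ≡⟨ +-identityʳ D ⟩
        D                                                       ∎)
      where
        open ≡-Reasoning
        t u D : ℚ
        t = chebyshevT x j
        u = chebyshevU x j
        D = (1ℚ - x) * (x - - 1ℚ) * (u * u)
        by-pell : ∀ x t u → 1ℚ - t * t ≡ (1ℚ - x) * (x - - 1ℚ) * (u * u) + (1ℚ - (t * t - (x * x - 1ℚ) * (u * u)))
        by-pell = solve-∀ ℚ-ring

  -- One step of the recurrence at x = 1 + δ, J standing for j + 1.
  chebyshev-lower-step : ∀ {δ J t u} → 0ℚ ≤ δ → 0ℚ ≤ J → 1ℚ + J * J * δ ≤ t → J ≤ u →
    (1ℚ + (1ℚ + J) * (1ℚ + J) * δ ≤ (1ℚ + δ) * t + ((1ℚ + δ) * (1ℚ + δ) - 1ℚ) * u)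
    × (1ℚ + J ≤ t + (1ℚ + δ) * u)
  chebyshev-lower-step {δ} {J} {t} {u} 0≤δ 0≤J t≥ u≥ =
    ≤-by-difference (J * J * δ * δ + (1ℚ + δ) * E + δ * δ * J + (δ + δ + δ * δ) * F)
      (+-nonNeg (+-nonNeg (+-nonNeg (*-nonNeg (*-nonNeg 0≤J² 0≤δ) 0≤δ) (*-nonNeg 0≤1+δ 0≤E))
        (*-nonNeg (*-nonNeg 0≤δ 0≤δ) 0≤J)) (*-nonNeg 0≤2δ+δ² 0≤F))
      (stepT δ J t u)
    , ≤-by-difference (J * J * δ + E + δ * J + (1ℚ + δ) * F)
      (+-nonNeg (+-nonNeg (+-nonNeg (*-nonNeg 0≤J² 0≤δ) 0≤E) (*-nonNeg 0≤δ 0≤J)) (*-nonNeg 0≤1+δ 0≤F))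
      (stepU δ J t u)
    where
      E F : ℚ
      E = t - (1ℚ + J * J * δ)
      F = u - J
      0≤E : 0ℚ ≤ E
      0≤E = 0≤-difference t≥
      0≤F : 0ℚ ≤ F
      0≤F = 0≤-difference u≥
      0≤J² : 0ℚ ≤ J * J
      0≤J² = *-nonNeg 0≤J 0≤J
      0≤1+δ : 0ℚ ≤ 1ℚ + δ
      0≤1+δ = +-nonNeg 0≤1 0≤δ
      0≤2δ+δ² : 0ℚ ≤ δ + δ + δ * δ
      0≤2δ+δ² = +-nonNeg (+-nonNeg 0≤δ 0≤δ) (*-nonNeg 0≤δ 0≤δ)
      stepT : ∀ δ J t u →
        ((1ℚ + δ) * t + ((1ℚ + δ) * (1ℚ + δ) - 1ℚ) * u) - (1ℚ + (1ℚ + J) * (1ℚ + J) * δ)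
          ≡ J * J * δ * δ + (1ℚ + δ) * (t - (1ℚ + J * J * δ)) + δ * δ * J + (δ + δ + δ * δ) * (u - J)
      stepT = solve-∀ ℚ-ring
      stepU : ∀ δ J t u →
        (t + (1ℚ + δ) * u) - (1ℚ + J) ≡ J * J * δ + (t - (1ℚ + J * J * δ)) + δ * J + (1ℚ + δ) * (u - J)
      stepU = solve-∀ ℚ-ring

  chebyshev-lower : ∀ {δ} j → 0ℚ ≤ δ → let J = fromℕ (suc j) in
    (1ℚ + J * J * δ ≤ chebyshevT (1ℚ + δ) j) × (J ≤ chebyshevU (1ℚ + δ) j)
  chebyshev-lower {δ} zero    0≤δ = ≤-by-difference 0ℚ ≤-refl (base δ) , ≤-refl
    where
      base : ∀ δ → 1ℚ + δ - (1ℚ + (1ℚ + 0ℚ) * (1ℚ + 0ℚ) * δ) ≡ 0ℚ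
      base = solve-∀ ℚ-ring
  chebyshev-lower {δ} (suc j) 0≤δ = let (t≥ , u≥) = chebyshev-lower j 0≤δ in
    chebyshev-lower-step 0≤δ (fromℕ-nonNeg (suc j)) t≥ u≥

  chebyshev-upper-step : ∀ {δ J t u} → 0ℚ ≤ δ → 0ℚ ≤ J → J * J * δ ≤ 1ℚ →
    t ≤ 1ℚ + J * J * δ + (J * J * δ) * (J * J * δ) → u ≤ J * (1ℚ + J * J * δ) →
    let J′ = 1ℚ + J in
    ((1ℚ + δ) * t + ((1ℚ + δ) * (1ℚ + δ) - 1ℚ) * u ≤ 1ℚ + J′ * J′ * δ + (J′ * J′ * δ) * (J′ * J′ * δ))
    × (t + (1ℚ + δ) * u ≤ J′ * (1ℚ + J′ * J′ * δ))
  chebyshev-upper-step {δ} {J} {t} {u} 0≤δ 0≤J J²δ≤1 t≤ u≤ =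
    ≤-by-difference ((1ℚ + δ) * E + (δ + δ + δ * δ) * F
                      + δ * δ * (J * J * J + J * J * J + (1ℚ + 1ℚ + 1ℚ + 1ℚ) * J * J + J * J * w + (1ℚ + 1ℚ) * J + J * w + 1ℚ))
      (+-nonNeg (+-nonNeg (*-nonNeg 0≤1+δ 0≤E) (*-nonNeg 0≤2δ+δ² 0≤F))
        (*-nonNeg (*-nonNeg 0≤δ 0≤δ)
          (+-nonNeg (+-nonNeg (+-nonNeg (+-nonNeg (+-nonNeg (+-nonNeg 0≤J³ 0≤J³) (*-nonNeg (*-nonNeg 0≤4 0≤J) 0≤J))
            (*-nonNeg 0≤J² 0≤w)) (*-nonNeg 0≤2 0≤J)) (*-nonNeg 0≤J 0≤w)) 0≤1)))
      (stepT δ J t u)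
    , ≤-by-difference (E + (1ℚ + δ) * F + δ * J * J * (1ℚ + w) + δ * J * (1ℚ + w) + δ)
      (+-nonNeg (+-nonNeg (+-nonNeg (+-nonNeg 0≤E (*-nonNeg 0≤1+δ 0≤F))
        (*-nonNeg (*-nonNeg (*-nonNeg 0≤δ 0≤J) 0≤J) 0≤1+w)) (*-nonNeg (*-nonNeg 0≤δ 0≤J) 0≤1+w)) 0≤δ)
      (stepU δ J t u)
    where
      E F w : ℚ
      E = 1ℚ + J * J * δ + (J * J * δ) * (J * J * δ) - t
      F = J * (1ℚ + J * J * δ) - u
      w = 1ℚ - J * J * δ
      0≤E : 0ℚ ≤ E
      0≤E = 0≤-difference t≤
      0≤F : 0ℚ ≤ F
      0≤F = 0≤-difference u≤
      0≤w : 0ℚ ≤ w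
      0≤w = 0≤-difference J²δ≤1
      0≤1+w : 0ℚ ≤ 1ℚ + w
      0≤1+w = +-nonNeg 0≤1 0≤w
      0≤J² : 0ℚ ≤ J * J
      0≤J² = *-nonNeg 0≤J 0≤J
      0≤J³ : 0ℚ ≤ J * J * J
      0≤J³ = *-nonNeg 0≤J² 0≤J
      0≤2 : 0ℚ ≤ 1ℚ + 1ℚ
      0≤2 = +-nonNeg 0≤1 0≤1
      0≤4 : 0ℚ ≤ 1ℚ + 1ℚ + 1ℚ + 1ℚ
      0≤4 = +-nonNeg (+-nonNeg 0≤2 0≤1) 0≤1
      0≤1+δ : 0ℚ ≤ 1ℚ + δ
      0≤1+δ = +-nonNeg 0≤1 0≤δ
      0≤2δ+δ² : 0ℚ ≤ δ + δ + δ * δ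
      0≤2δ+δ² = +-nonNeg (+-nonNeg 0≤δ 0≤δ) (*-nonNeg 0≤δ 0≤δ)
      stepT : ∀ δ J t u →
        1ℚ + (1ℚ + J) * (1ℚ + J) * δ + ((1ℚ + J) * (1ℚ + J) * δ) * ((1ℚ + J) * (1ℚ + J) * δ)
          - ((1ℚ + δ) * t + ((1ℚ + δ) * (1ℚ + δ) - 1ℚ) * u)
        ≡ (1ℚ + δ) * (1ℚ + J * J * δ + (J * J * δ) * (J * J * δ) - t) + (δ + δ + δ * δ) * (J * (1ℚ + J * J * δ) - u)
          + δ * δ * (J * J * J + J * J * J + (1ℚ + 1ℚ + 1ℚ + 1ℚ) * J * J + J * J * (1ℚ - J * J * δ)
                     + (1ℚ + 1ℚ) * J + J * (1ℚ - J * J * δ) + 1ℚ)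
      stepT = solve-∀ ℚ-ring
      stepU : ∀ δ J t u →
        (1ℚ + J) * (1ℚ + (1ℚ + J) * (1ℚ + J) * δ) - (t + (1ℚ + δ) * u)
        ≡ (1ℚ + J * J * δ + (J * J * δ) * (J * J * δ) - t) + (1ℚ + δ) * (J * (1ℚ + J * J * δ) - u)
          + δ * J * J * (1ℚ + (1ℚ - J * J * δ)) + δ * J * (1ℚ + (1ℚ - J * J * δ)) + δ
      stepU = solve-∀ ℚ-ring

  chebyshev-upper : ∀ {δ} j → 0ℚ ≤ δ → let J = fromℕ (suc j) in J * J * δ ≤ 1ℚ →
    (chebyshevT (1ℚ + δ) j ≤ 1ℚ + J * J * δ + (J * J * δ) * (J * J * δ))
    × (chebyshevU (1ℚ + δ) j ≤ J * (1ℚ + J * J * δ))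
  chebyshev-upper {δ} zero 0≤δ _ = ≤-by-difference (δ * δ) (*-nonNeg 0≤δ 0≤δ) (baseT δ)
                                 , ≤-by-difference δ 0≤δ (baseU δ)
    where
      baseT : ∀ δ → 1ℚ + (1ℚ + 0ℚ) * (1ℚ + 0ℚ) * δ + ((1ℚ + 0ℚ) * (1ℚ + 0ℚ) * δ) * ((1ℚ + 0ℚ) * (1ℚ + 0ℚ) * δ) - (1ℚ + δ) ≡ δ * δ
      baseT = solve-∀ ℚ-ring
      baseU : ∀ δ → (1ℚ + 0ℚ) * (1ℚ + (1ℚ + 0ℚ) * (1ℚ + 0ℚ) * δ) - 1ℚ ≡ δ
      baseU = solve-∀ ℚ-ring
  chebyshev-upper {δ} (suc j) 0≤δ J′²δ≤1 = let (t≤ , u≤) = chebyshev-upper j 0≤δ J²δ≤1 in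
    chebyshev-upper-step 0≤δ 0≤J J²δ≤1 t≤ u≤
    where
      0≤J : 0ℚ ≤ fromℕ (suc j)
      0≤J = fromℕ-nonNeg (suc j)
      J²δ≤1 : fromℕ (suc j) * fromℕ (suc j) * δ ≤ 1ℚ
      J²δ≤1 = ≤-trans (*-monoʳ-≤-nonNeg δ {{nonNegative 0≤δ}}
                (square-mono-≤ 0≤J (fromℕ-mono-≤ (ℕ.n≤1+n (suc j))))) J′²δ≤1

module Polynomials {V : Set} where

  open Rationals
  open Chebyshev
  open import Data.Nat as ℕ using (ℕ; zero; suc)
  import Data.Nat.Properties as ℕ
  open import Data.Rational using (ℚ; 0ℚ; 1ℚ; _+_; _*_; _-_; -_)
  open import Data.Rational.Properties
    using (*-zeroˡ; *-zeroʳ; *-identityˡ; *-assoc; +-identityˡ; +-assoc; *-distribʳ-+; *-distribˡ-+)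
  open import Data.Bool using (Bool; true; false)
  open import Data.List using (List; []; _∷_; _++_; map; length; foldr)
  open import Data.List.Properties using (length-++)
  open import Data.List.Relation.Unary.All using (All; []; _∷_)
  open import Data.Product using (_×_; _,_; proj₁; proj₂)
  open import Relation.Binary.PropositionalEquality using (_≡_; refl; sym; trans; cong; cong₂; subst)
  open import Tactic.RingSolver using (solve-∀)

  infixl 6 _+ᴾ_ _-ᴾ_
  infixl 7 _*ᴾ_
  infixr 8 _^ᴾ_

  constᴾ : ℚ → Poly V
  constᴾ c = (c , []) ∷ []

  varᴾ : V → Poly V
  varᴾ v = (1ℚ , v ∷ []) ∷ []

  _+ᴾ_ : Poly V → Poly V → Poly V
  _+ᴾ_ = _++_

  scaleᴾ : ℚ → Poly V → Poly V
  scaleᴾ c = map (λ (a , vs) → (c * a , vs))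

  _-ᴾ_ : Poly V → Poly V → Poly V
  p -ᴾ q = p +ᴾ scaleᴾ (- 1ℚ) q

  _*ᴾ_ : Poly V → Poly V → Poly V
  []      *ᴾ q = []
  (m ∷ p) *ᴾ q = map (λ (b , ws) → (proj₁ m * b , proj₂ m ++ ws)) q ++ (p *ᴾ q)

  _^ᴾ_ : Poly V → ℕ → Poly V
  p ^ᴾ zero  = constᴾ 1ℚ
  p ^ᴾ suc n = p *ᴾ (p ^ᴾ n)

  ∑ᴾ : {A : Set} → (A → Poly V) → List A → Poly V
  ∑ᴾ f = foldr (λ a q → f a +ᴾ q) []

  chebyshevᴾ : Poly V → ℕ → Poly V × Poly V
  chebyshevᴾ L zero    = L , constᴾ 1ℚ
  chebyshevᴾ L (suc j) = let (T , U) = chebyshevᴾ L j in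
    L *ᴾ T +ᴾ (L *ᴾ L -ᴾ constᴾ 1ℚ) *ᴾ U , T +ᴾ L *ᴾ U

  guardᴾ : Bool → Poly V → Poly V
  guardᴾ true  p = p
  guardᴾ false p = []

  chebyshevTᴾ : Poly V → ℕ → Poly V
  chebyshevTᴾ L j = proj₁ (chebyshevᴾ L j)

  module _ (x : V → Bool) where

    monomial : List V → ℚ
    monomial = foldr (λ v r → boolToℚ (x v) * r) 1ℚ

    monomial-++ : ∀ vs ws → monomial (vs ++ ws) ≡ monomial vs * monomial ws
    monomial-++ []       ws = sym (*-identityˡ (monomial ws))
    monomial-++ (v ∷ vs) ws = trans (cong (boolToℚ (x v) *_) (monomial-++ vs ws))
                                    (sym (*-assoc (boolToℚ (x v)) (monomial vs) (monomial ws)))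

    eval-+ᴾ : ∀ p q → eval (p +ᴾ q) x ≡ eval p x + eval q x
    eval-+ᴾ []      q = sym (+-identityˡ (eval q x))
    eval-+ᴾ (m ∷ p) q = trans (cong (evalMon x m +_) (eval-+ᴾ p q)) (sym (+-assoc (evalMon x m) (eval p x) (eval q x)))

    eval-constᴾ : ∀ c → eval (constᴾ c) x ≡ c
    eval-constᴾ c = lemma c
      where
        lemma : ∀ c → c * 1ℚ + 0ℚ ≡ c
        lemma = solve-∀ ℚ-ring

    eval-varᴾ : ∀ v → eval (varᴾ v) x ≡ boolToℚ (x v)
    eval-varᴾ v = lemma (boolToℚ (x v))
      where
        lemma : ∀ c → 1ℚ * (c * 1ℚ) + 0ℚ ≡ c
        lemma = solve-∀ ℚ-ring

    eval-scaleᴾ : ∀ c p → eval (scaleᴾ c p) x ≡ c * eval p x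
    eval-scaleᴾ c []             = sym (*-zeroʳ c)
    eval-scaleᴾ c ((a , vs) ∷ p) = trans (cong (c * a * monomial vs +_) (eval-scaleᴾ c p)) (distrib c a (monomial vs) (eval p x))
      where
        distrib : ∀ c a b d → c * a * b + c * d ≡ c * (a * b + d)
        distrib = solve-∀ ℚ-ring

    eval--ᴾ : ∀ p q → eval (p -ᴾ q) x ≡ eval p x - eval q x
    eval--ᴾ p q = trans (eval-+ᴾ p (scaleᴾ (- 1ℚ) q))
      (trans (cong (eval p x +_) (eval-scaleᴾ (- 1ℚ) q)) (lemma (eval p x) (eval q x)))
      where
        lemma : ∀ a b → a + - 1ℚ * b ≡ a - b
        lemma = solve-∀ ℚ-ring

    eval-*ᴾ : ∀ p q → eval (p *ᴾ q) x ≡ eval p x * eval q x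
    eval-*ᴾ []             q = sym (*-zeroˡ (eval q x))
    eval-*ᴾ ((a , vs) ∷ p) q =
      trans (eval-+ᴾ (map (λ (b , ws) → (a * b , vs ++ ws)) q) (p *ᴾ q))
        (trans (cong₂ _+_ (eval-monomial-* q) (eval-*ᴾ p q)) (sym (*-distribʳ-+ (eval q x) (a * monomial vs) (eval p x))))
      where
        reorder : ∀ a b c d → a * b * (c * d) ≡ a * c * (b * d)
        reorder = solve-∀ ℚ-ring
        eval-monomial-* : ∀ q → eval (map (λ (b , ws) → (a * b , vs ++ ws)) q) x ≡ a * monomial vs * eval q x
        eval-monomial-* []             = sym (*-zeroʳ (a * monomial vs))
        eval-monomial-* ((b , ws) ∷ q) =
          trans (cong₂ _+_ (trans (cong (a * b *_) (monomial-++ vs ws)) (reorder a b (monomial vs) (monomial ws)))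
                           (eval-monomial-* q))
                (sym (*-distribˡ-+ (a * monomial vs) (b * monomial ws) (eval q x)))

    eval-^ᴾ : ∀ p n → eval (p ^ᴾ n) x ≡ eval p x ^ n
    eval-^ᴾ p zero    = eval-constᴾ 1ℚ
    eval-^ᴾ p (suc n) = trans (eval-*ᴾ p (p ^ᴾ n)) (cong (eval p x *_) (eval-^ᴾ p n))

    eval-∑ᴾ : ∀ {A : Set} (f : A → Poly V) l → eval (∑ᴾ f l) x ≡ ∑ (λ a → eval (f a) x) l
    eval-∑ᴾ f []      = refl
    eval-∑ᴾ f (a ∷ l) = trans (eval-+ᴾ (f a) (∑ᴾ f l)) (cong (eval (f a) x +_) (eval-∑ᴾ f l))

    eval-chebyshevᴾ : ∀ L j → let (T , U) = chebyshevᴾ L j in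
      (eval T x ≡ chebyshevT (eval L x) j) × (eval U x ≡ chebyshevU (eval L x) j)
    eval-chebyshevᴾ L zero    = refl , eval-constᴾ 1ℚ
    eval-chebyshevᴾ L (suc j) =
      trans (eval-+ᴾ (L *ᴾ T) ((L *ᴾ L -ᴾ constᴾ 1ℚ) *ᴾ U))
        (cong₂ _+_ (trans (eval-*ᴾ L T) (cong (eval L x *_) (proj₁ IH)))
                   (trans (eval-*ᴾ (L *ᴾ L -ᴾ constᴾ 1ℚ) U)
                     (cong₂ _*_ (trans (eval--ᴾ (L *ᴾ L) (constᴾ 1ℚ)) (cong₂ _-_ (eval-*ᴾ L L) (eval-constᴾ 1ℚ)))
                                (proj₂ IH))))
      , trans (eval-+ᴾ T (L *ᴾ U)) (cong₂ _+_ (proj₁ IH) (trans (eval-*ᴾ L U) (cong (eval L x *_) (proj₂ IH))))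
      where
        T U : Poly V
        T = proj₁ (chebyshevᴾ L j)
        U = proj₂ (chebyshevᴾ L j)
        IH = eval-chebyshevᴾ L j

  Deg≤ : ℕ → Poly V → Set
  Deg≤ d = All (λ (_ , vs) → length vs ℕ.≤ d)

  degree-≤ : ∀ {d} p → Deg≤ d p → degree p ℕ.≤ d
  degree-≤ []      []       = ℕ.z≤n
  degree-≤ (_ ∷ p) (h ∷ hs) = ℕ.⊔-lub h (degree-≤ p hs)

  deg-constᴾ : ∀ {d} c → Deg≤ d (constᴾ c)
  deg-constᴾ c = ℕ.z≤n ∷ []

  deg-varᴾ : ∀ v → Deg≤ 1 (varᴾ v)
  deg-varᴾ v = ℕ.≤-refl ∷ []

  deg-+ᴾ : ∀ {d p q} → Deg≤ d p → Deg≤ d q → Deg≤ d (p +ᴾ q)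
  deg-+ᴾ []       hq = hq
  deg-+ᴾ (h ∷ hp) hq = h ∷ deg-+ᴾ hp hq

  deg-scaleᴾ : ∀ {d p} c → Deg≤ d p → Deg≤ d (scaleᴾ c p)
  deg-scaleᴾ c []       = []
  deg-scaleᴾ c (h ∷ hs) = h ∷ deg-scaleᴾ c hs

  deg--ᴾ : ∀ {d p q} → Deg≤ d p → Deg≤ d q → Deg≤ d (p -ᴾ q)
  deg--ᴾ hp hq = deg-+ᴾ hp (deg-scaleᴾ (- 1ℚ) hq)

  deg-*ᴾ : ∀ {d e p q} → Deg≤ d p → Deg≤ e q → Deg≤ (d ℕ.+ e) (p *ᴾ q)
  deg-*ᴾ {p = []}          []       hq = []
  deg-*ᴾ {p = (a , vs) ∷ p} (h ∷ hp) hq = deg-+ᴾ (deg-monomial-* hq) (deg-*ᴾ hp hq)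
    where
      deg-monomial-* : ∀ {q} → Deg≤ _ q → Deg≤ _ (map (λ (b , ws) → (a * b , vs ++ ws)) q)
      deg-monomial-* []                 = []
      deg-monomial-* {(_ , ws) ∷ _} (h′ ∷ hs) =
        subst (ℕ._≤ _) (sym (length-++ vs)) (ℕ.+-mono-≤ h h′) ∷ deg-monomial-* hs

  deg-^ᴾ : ∀ {d p} n → Deg≤ d p → Deg≤ (n ℕ.* d) (p ^ᴾ n)
  deg-^ᴾ zero    hp = deg-constᴾ 1ℚ
  deg-^ᴾ (suc n) hp = deg-*ᴾ hp (deg-^ᴾ n hp)

  deg-∑ᴾ : ∀ {d} {A : Set} (f : A → Poly V) l → (∀ a → Deg≤ d (f a)) → Deg≤ d (∑ᴾ f l)
  deg-∑ᴾ f []      hf = []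
  deg-∑ᴾ f (a ∷ l) hf = deg-+ᴾ (hf a) (deg-∑ᴾ f l hf)

  deg-guardᴾ : ∀ {d p} b → Deg≤ d p → Deg≤ d (guardᴾ b p)
  deg-guardᴾ true  hp = hp
  deg-guardᴾ false _  = []

  deg-chebyshevᴾ : ∀ {D L} j → Deg≤ D L →
    Deg≤ (suc j ℕ.* D) (proj₁ (chebyshevᴾ L j)) × Deg≤ (j ℕ.* D) (proj₂ (chebyshevᴾ L j))
  deg-chebyshevᴾ {D} {L} zero    hL = subst (λ d → Deg≤ d L) (sym (ℕ.+-identityʳ D)) hL , deg-constᴾ 1ℚ
  deg-chebyshevᴾ {D} {L} (suc j) hL =
    deg-+ᴾ (deg-*ᴾ hL (proj₁ IH))
      (subst (λ d → Deg≤ d ((L *ᴾ L -ᴾ constᴾ 1ℚ) *ᴾ proj₂ (chebyshevᴾ L j))) (ℕ.+-assoc D D (j ℕ.* D)) (deg-*ᴾ (deg--ᴾ (deg-*ᴾ hL hL) (deg-constᴾ 1ℚ)) (proj₂ IH)))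
    , deg-+ᴾ (proj₁ IH) (deg-*ᴾ hL (proj₂ IH))
    where
      IH = deg-chebyshevᴾ j hL


module Counting where

  open Rationals
  open import Data.Nat as ℕ using (ℕ; zero; suc)
  import Data.Nat.Properties as ℕ
  open import Data.Rational using (ℚ; 0ℚ; 1ℚ; _+_; _*_; _-_; _≤_)
  open import Data.Rational.Properties using (≤-refl; ≤-trans; ≤-reflexive; +-mono-≤; +-identityˡ)
  open import Data.Bool using (Bool; true; false; not)
  open import Data.Bool.ListAction using (and; or; any; all)
  open import Data.List using (List; []; _∷_; map; length; tabulate; allFin)
  open import Data.List.Membership.Propositional using (_∈_)
  open import Data.List.Relation.Unary.Any using (here; there)
  open import Data.Empty using (⊥)
  open import Data.List.Properties using (map-tabulate; length-tabulate; length-map)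
  open import Data.Fin using (Fin; zero; suc)
  import Data.Fin.Properties as Fin
  open import Data.Product using (_×_; _,_; proj₁; proj₂)
  open import Relation.Binary.PropositionalEquality using (_≡_; refl; sym; trans; cong; cong₂; subst)
  open import Tactic.RingSolver using (solve-∀)

  1-boolToℚ : ∀ b → 1ℚ - boolToℚ b ≡ boolToℚ (not b)
  1-boolToℚ true  = refl
  1-boolToℚ false = refl

  b∧not-b : ∀ b → b ≡ true → not b ≡ true → ⊥
  b∧not-b true _ ()

  all-elim : ∀ {A : Set} (f : A → Bool) l {a} → all f l ≡ true → a ∈ l → f a ≡ true
  all-elim f (b ∷ l) all-f (here refl) with f b
  ... | true = refl
  all-elim f (b ∷ l) all-f (there a∈l) with f b
  ... | true = all-elim f l all-f a∈l

  count : List Bool → ℕ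
  count []           = 0
  count (true  ∷ bs) = suc (count bs)
  count (false ∷ bs) = count bs

  count-≤-length : ∀ bs → count bs ℕ.≤ length bs
  count-≤-length []           = ℕ.z≤n
  count-≤-length (true  ∷ bs) = ℕ.s≤s (count-≤-length bs)
  count-≤-length (false ∷ bs) = ℕ.m≤n⇒m≤1+n (count-≤-length bs)

  and⇒count≡length : ∀ bs → and bs ≡ true → count bs ≡ length bs
  and⇒count≡length []          _  = refl
  and⇒count≡length (true ∷ bs) eq = cong suc (and⇒count≡length bs eq)

  ¬and⇒count<length : ∀ bs → and bs ≡ false → count bs ℕ.< length bs
  ¬and⇒count<length (true  ∷ bs) eq = ℕ.s≤s (¬and⇒count<length bs eq)
  ¬and⇒count<length (false ∷ bs) _  = ℕ.s≤s (count-≤-length bs)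

  ¬or⇒count≡0 : ∀ bs → or bs ≡ false → count bs ≡ 0
  ¬or⇒count≡0 []           _  = refl
  ¬or⇒count≡0 (false ∷ bs) eq = ¬or⇒count≡0 bs eq

  or⇒count≥1 : ∀ bs → or bs ≡ true → 1 ℕ.≤ count bs
  or⇒count≥1 (true  ∷ bs) _  = ℕ.s≤s ℕ.z≤n
  or⇒count≥1 (false ∷ bs) eq = or⇒count≥1 bs eq

  count≤1⇒count≡or : ∀ bs → count bs ℕ.≤ 1 → fromℕ (count bs) ≡ boolToℚ (or bs)
  count≤1⇒count≡or bs c≤1 with or bs in eq
  ... | false = cong fromℕ (¬or⇒count≡0 bs eq)
  ... | true  = cong fromℕ (ℕ.≤-antisym c≤1 (or⇒count≥1 bs eq))

  length-map-allFin : ∀ {A : Set} {n} (h : Fin n → A) → length (map h (allFin n)) ≡ n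
  length-map-allFin {n = n} h = trans (length-map h (allFin n)) (length-tabulate {n = n} (λ i → i))

  count-tabulate-false : ∀ {n} (h : Fin n → Bool) → (∀ i → h i ≡ false) → count (tabulate h) ≡ 0
  count-tabulate-false {zero}  h _ = refl
  count-tabulate-false {suc n} h all-false rewrite all-false zero =
    count-tabulate-false (λ i → h (suc i)) (λ i → all-false (suc i))

  count-tabulate-unique : ∀ {n} (h : Fin n → Bool) →
    (∀ i j → h i ≡ true → h j ≡ true → i ≡ j) → count (tabulate h) ℕ.≤ 1
  count-tabulate-unique {zero}  h _      = ℕ.z≤n
  count-tabulate-unique {suc n} h unique with h zero in h0
  ... | true  = ℕ.s≤s (ℕ.≤-reflexive (count-tabulate-false (λ i → h (suc i)) rest-false))
    where
      rest-false : ∀ i → h (suc i) ≡ false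
      rest-false i with h (suc i) in hi
      ... | true with () ← unique zero (suc i) h0 hi
      ... | false = refl
  ... | false = count-tabulate-unique (λ i → h (suc i)) (λ i j hi hj → Fin.suc-injective (unique (suc i) (suc j) hi hj))

  ∑-cong : ∀ {A : Set} {f g : A → ℚ} l → (∀ a → f a ≡ g a) → ∑ f l ≡ ∑ g l
  ∑-cong []      f≗g = refl
  ∑-cong (a ∷ l) f≗g = cong₂ _+_ (f≗g a) (∑-cong l f≗g)

  ∑-boolToℚ : ∀ {A : Set} (h : A → Bool) l → ∑ (λ a → boolToℚ (h a)) l ≡ fromℕ (count (map h l))
  ∑-boolToℚ h []      = refl
  ∑-boolToℚ h (a ∷ l) with h a
  ... | true  = cong (1ℚ +_) (∑-boolToℚ h l)
  ... | false = trans (+-identityˡ _) (∑-boolToℚ h l)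

  ∑-sandwich : ∀ {A : Set} (f g : A → ℚ) δ → (∀ a → g a ≤ f a) → (∀ a → f a ≤ g a + δ) → ∀ l →
    (∑ g l ≤ ∑ f l) × (∑ f l ≤ ∑ g l + fromℕ (length l) * δ)
  ∑-sandwich f g δ g≤f f≤g+δ []      = ≤-refl , ≤-reflexive (base δ)
    where
      base : ∀ δ → 0ℚ ≡ 0ℚ + 0ℚ * δ
      base = solve-∀ ℚ-ring
  ∑-sandwich f g δ g≤f f≤g+δ (a ∷ l) =
    +-mono-≤ (g≤f a) (proj₁ IH) ,
    ≤-trans (+-mono-≤ (f≤g+δ a) (proj₂ IH)) (≤-reflexive (regroup (g a) (∑ g l) (fromℕ (length l)) δ))
    where
      IH = ∑-sandwich f g δ g≤f f≤g+δ l
      regroup : ∀ x s n δ → x + δ + (s + n * δ) ≡ x + s + (1ℚ + n) * δ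
      regroup = solve-∀ ℚ-ring

  ∑-approximates-any : ∀ {k} (h : Fin k → Bool) (f : Fin k → ℚ) {ε} → 0ℚ ≤ ε →
    (∀ i j → h i ≡ true → h j ≡ true → i ≡ j) →
    (∀ i → h i ≡ true → f i ≡ 1ℚ) → (∀ i → h i ≡ false → 0ℚ ≤ f i × f i ≤ ε) →
    (boolToℚ (any h (allFin k)) ≤ ∑ f (allFin k)) × (∑ f (allFin k) ≤ boolToℚ (any h (allFin k)) + fromℕ k * ε)
  ∑-approximates-any {k} h f {ε} 0≤ε unique hit miss =
    subst (λ b → (b ≤ ∑ f (allFin k)) × (∑ f (allFin k) ≤ b + fromℕ k * ε)) ∑h≡any
      (subst (λ n → (∑ h′ (allFin k) ≤ ∑ f (allFin k)) × (∑ f (allFin k) ≤ ∑ h′ (allFin k) + fromℕ n * ε))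
        (length-tabulate {n = k} (λ i → i))
        (∑-sandwich f h′ ε lower upper (allFin k)))
    where
      h′ : Fin k → ℚ
      h′ i = boolToℚ (h i)
      lower : ∀ i → h′ i ≤ f i
      lower i with h i in hi
      ... | true  = ≤-reflexive (sym (hit i hi))
      ... | false = proj₁ (miss i hi)
      upper : ∀ i → f i ≤ h′ i + ε
      upper i with h i in hi
      ... | true  = ≤-trans (≤-reflexive (hit i hi)) (p≤p+q 0≤ε)
      ... | false = subst (f i ≤_) (sym (+-identityˡ ε)) (proj₂ (miss i hi))
      ∑h≡any : ∑ h′ (allFin k) ≡ boolToℚ (any h (allFin k))
      ∑h≡any = trans (∑-boolToℚ h (allFin k))
        (count≤1⇒count≡or (map h (allFin k))
          (subst (λ bs → count bs ℕ.≤ 1) (sym (map-tabulate (λ i → i) h)) (count-tabulate-unique h unique)))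


module Gadget where

  open Rationals
  open Chebyshev
  open Polynomials
  open import Data.Nat as ℕ using (ℕ; suc)
  open import Data.Rational using (ℚ; _+_; _*_)
  open import Data.Bool using (Bool)
  open import Data.Product using (proj₁)
  open import Relation.Binary.PropositionalEquality using (_≡_; trans; cong; cong₂)

  gadget : (a b c : ℚ) (j p : ℕ) → ℚ → ℚ
  gadget a b c j p z = (c * (chebyshevT (a + b * z) j * chebyshevT (a + b * z) j)) ^ p

  gadgetᴾ : {V : Set} (a b c : ℚ) (j p : ℕ) → Poly V → Poly V
  gadgetᴾ a b c j p W = scaleᴾ c (T *ᴾ T) ^ᴾ p
    where T = chebyshevTᴾ (constᴾ a +ᴾ scaleᴾ b W) j

  eval-gadgetᴾ : ∀ {V} a b c j p (W : Poly V) x → eval (gadgetᴾ a b c j p W) x ≡ gadget a b c j p (eval W x)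
  eval-gadgetᴾ {V} a b c j p W x =
    trans (eval-^ᴾ x (scaleᴾ c (T *ᴾ T)) p)
      (cong (_^ p) (trans (eval-scaleᴾ x c (T *ᴾ T)) (cong (c *_) (trans (eval-*ᴾ x T T) (cong₂ _*_ eval-T eval-T)))))
    where
      L T : Poly V
      L = constᴾ a +ᴾ scaleᴾ b W
      T = chebyshevTᴾ L j
      eval-L : eval L x ≡ a + b * eval W x
      eval-L = trans (eval-+ᴾ x (constᴾ a) (scaleᴾ b W)) (cong₂ _+_ (eval-constᴾ x a) (eval-scaleᴾ x b W))
      eval-T : eval T x ≡ chebyshevT (a + b * eval W x) j
      eval-T = trans (proj₁ (eval-chebyshevᴾ x L j)) (cong (λ z → chebyshevT z j) eval-L)

  deg-gadgetᴾ : ∀ {V D} a b c j p {W : Poly V} → Deg≤ D W →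
    Deg≤ (p ℕ.* (suc j ℕ.* D ℕ.+ suc j ℕ.* D)) (gadgetᴾ a b c j p W)
  deg-gadgetᴾ a b c j p hW = deg-^ᴾ p (deg-scaleᴾ c (deg-*ᴾ deg-T deg-T))
    where deg-T = proj₁ (deg-chebyshevᴾ j (deg-+ᴾ (deg-constᴾ a) (deg-scaleᴾ b hW)))


module Threshold (n j p : ℕ) (1≤n : 1 ℕ.≤ n) (n≤J² : n ℕ.≤ suc j ℕ.* suc j) where

  open Rationals
  open Chebyshev
  open Polynomials
  open Counting
  open Gadget
  import Data.Nat.Properties as ℕ
  open import Data.Rational using (ℚ; 0ℚ; 1ℚ; _+_; _*_; _-_; -_; _≤_; _<_; _/_; *<*; nonNegative)
  open import Data.Rational.Properties
  open import Data.Integer using (+_; +<+)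
  open import Data.Bool using (Bool; true; false)
  open import Data.Bool.ListAction using (all)
  open import Data.List using (allFin; map)
  open import Data.Fin using (Fin)
  open import Data.Product using (_×_; _,_; proj₁; proj₂)
  open import Relation.Binary.PropositionalEquality using (_≡_; refl; sym; trans; cong; subst; module ≡-Reasoning)
  open import Tactic.RingSolver using (solve-∀)

  ρ : ℚ
  ρ = reciprocal (fromℕ n) (fromℕ-pos 1≤n)

  ρn≡1 : ρ * fromℕ n ≡ 1ℚ
  ρn≡1 = reciprocal-inverseˡ (fromℕ n) (fromℕ-pos 1≤n)

  0≤ρ : 0ℚ ≤ ρ
  0≤ρ = reciprocal-nonNeg (fromℕ n) (fromℕ-pos 1≤n)

  -- The affine map t ↦ -1 + 2(t + 1)/n sends 0, …, n - 1 into [-1, 1] and n to 1 + 2/n.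
  peak : ℚ
  peak = chebyshevT (1ℚ + (ρ + ρ)) j

  3≤peak : 1ℚ + (1ℚ + 1ℚ) ≤ peak
  3≤peak = ≤-trans (+-monoʳ-≤ 1ℚ 2≤J²·2ρ) (proj₁ (chebyshev-lower j (+-nonNeg 0≤ρ 0≤ρ)))
    where
      open ≤-Reasoning
      J : ℚ
      J = fromℕ (suc j)
      two≡ : ∀ ρ N → 1ℚ + 1ℚ ≡ N * (ρ + ρ) + (1ℚ + 1ℚ) * (1ℚ - ρ * N)
      two≡ = solve-∀ ℚ-ring
      2≤J²·2ρ : 1ℚ + 1ℚ ≤ J * J * (ρ + ρ)
      2≤J²·2ρ = begin
        1ℚ + 1ℚ                                    ≡⟨ two≡ ρ (fromℕ n) ⟩
        fromℕ n * (ρ + ρ) + (1ℚ + 1ℚ) * (1ℚ - ρ * fromℕ n) ≡⟨ cong (λ z → fromℕ n * (ρ + ρ) + (1ℚ + 1ℚ) * (1ℚ - z)) ρn≡1 ⟩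
        fromℕ n * (ρ + ρ) + (1ℚ + 1ℚ) * 0ℚ          ≡⟨ +-identityʳ _ ⟩
        fromℕ n * (ρ + ρ)                          ≤⟨ *-monoʳ-≤-nonNeg (ρ + ρ) {{nonNegative (+-nonNeg 0≤ρ 0≤ρ)}}
                                                        (≤-trans (fromℕ-mono-≤ n≤J²) (≤-reflexive (fromℕ-* (suc j) (suc j)))) ⟩
        J * J * (ρ + ρ)                            ∎

  0<peak² : 0ℚ < peak * peak
  0<peak² = <-≤-trans (*<* (+<+ (ℕ.s≤s ℕ.z≤n))) (square-mono-≤ (≤ᵇ⇒≤ _) 3≤peak)

  c : ℚ
  c = reciprocal (peak * peak) 0<peak²

  0≤c : 0ℚ ≤ c
  0≤c = reciprocal-nonNeg (peak * peak) 0<peak²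

  c≤¼ : c ≤ ¼
  c≤¼ = inverse-antitone {a = + 4 / 1} 0≤c (reciprocal-inverseˡ (peak * peak) 0<peak²)
          (≤-trans (≤ᵇ⇒≤ _) (square-mono-≤ (≤ᵇ⇒≤ _) 3≤peak)) (≤ᵇ⇒≤ _) refl

  threshold : ℚ → ℚ
  threshold = gadget (ρ + ρ - 1ℚ) (ρ + ρ) c j p

  threshold-hit : threshold (fromℕ n) ≡ 1ℚ
  threshold-hit = begin
    threshold (fromℕ n)         ≡⟨ cong (λ z → (c * (chebyshevT z j * chebyshevT z j)) ^ p) affine-n ⟩
    (c * (peak * peak)) ^ p     ≡⟨ cong (_^ p) (reciprocal-inverseˡ (peak * peak) 0<peak²) ⟩
    1ℚ ^ p                      ≡⟨ 1^n≡1 p ⟩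
    1ℚ                          ∎
    where
      open ≡-Reasoning
      affine : ∀ ρ N → (ρ + ρ - 1ℚ) + (ρ + ρ) * N ≡ 1ℚ + (ρ + ρ) + (1ℚ + 1ℚ) * (ρ * N - 1ℚ)
      affine = solve-∀ ℚ-ring
      affine-n : (ρ + ρ - 1ℚ) + (ρ + ρ) * fromℕ n ≡ 1ℚ + (ρ + ρ)
      affine-n = trans (affine ρ (fromℕ n))
        (trans (cong (λ z → 1ℚ + (ρ + ρ) + (1ℚ + 1ℚ) * (z - 1ℚ)) ρn≡1) (+-identityʳ _))

  threshold-miss : ∀ t → t ℕ.< n → 0ℚ ≤ threshold (fromℕ t) × threshold (fromℕ t) ≤ ¼ ^ p
  threshold-miss t t<n = ^-nonNeg p 0≤cT² , ^-monoˡ-≤ p 0≤cT² cT²≤¼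
    where
      x T : ℚ
      x = (ρ + ρ - 1ℚ) + (ρ + ρ) * fromℕ t
      T = chebyshevT x j
      d : ℕ
      d = proj₁ (ℕ.m≤n⇒∃[o]m+o≡n t<n)
      ρ[1+t+d]≡1 : ρ * (1ℚ + fromℕ t + fromℕ d) ≡ 1ℚ
      ρ[1+t+d]≡1 = trans (cong (ρ *_) (sym (fromℕ-+ (suc t) d)))
                     (subst (λ m → ρ * fromℕ m ≡ 1ℚ) (sym (proj₂ (ℕ.m≤n⇒∃[o]m+o≡n t<n))) ρn≡1)
      -1≤x : - 1ℚ ≤ x
      -1≤x = ≤-by-difference ((ρ + ρ) * (1ℚ + fromℕ t)) (*-nonNeg (+-nonNeg 0≤ρ 0≤ρ) (fromℕ-nonNeg (suc t)))
               (lower ρ (fromℕ t))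
        where
          lower : ∀ ρ t → (ρ + ρ - 1ℚ) + (ρ + ρ) * t - - 1ℚ ≡ (ρ + ρ) * (1ℚ + t)
          lower = solve-∀ ℚ-ring
      x≤1 : x ≤ 1ℚ
      x≤1 = ≤-by-difference ((ρ + ρ) * fromℕ d) (*-nonNeg (+-nonNeg 0≤ρ 0≤ρ) (fromℕ-nonNeg d))
              (trans (upper ρ (fromℕ t) (fromℕ d))
                (trans (cong (λ z → (ρ + ρ) * fromℕ d + (1ℚ + 1ℚ) * (1ℚ - z)) ρ[1+t+d]≡1) (+-identityʳ _)))
        where
          upper : ∀ ρ t d → 1ℚ - ((ρ + ρ - 1ℚ) + (ρ + ρ) * t) ≡ (ρ + ρ) * d + (1ℚ + 1ℚ) * (1ℚ - ρ * (1ℚ + t + d))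
          upper = solve-∀ ℚ-ring
      0≤cT² : 0ℚ ≤ c * (T * T)
      0≤cT² = *-nonNeg 0≤c (0≤square T)
      cT²≤¼ : c * (T * T) ≤ ¼
      cT²≤¼ = ≤-trans (*-monoˡ-≤-nonNeg c {{nonNegative 0≤c}} (chebyshevT²≤1 j -1≤x x≤1))
                (≤-trans (≤-reflexive (*-identityʳ c)) c≤¼)

  module And {V : Set} (lit : Fin n → Poly V) (holds : (V → Bool) → Fin n → Bool)
           (eval-lit : ∀ x l → eval (lit l) x ≡ boolToℚ (holds x l)) (deg-lit : ∀ l → Deg≤ 1 (lit l)) where

    andᴾ : Poly V
    andᴾ = gadgetᴾ (ρ + ρ - 1ℚ) (ρ + ρ) c j p (∑ᴾ lit (allFin n))

    deg-andᴾ : Deg≤ (p ℕ.* (suc j ℕ.* 1 ℕ.+ suc j ℕ.* 1)) andᴾ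
    deg-andᴾ = deg-gadgetᴾ (ρ + ρ - 1ℚ) (ρ + ρ) c j p (deg-∑ᴾ lit (allFin n) deg-lit)

    eval-andᴾ : ∀ x → eval andᴾ x ≡ threshold (fromℕ (count (map (holds x) (allFin n))))
    eval-andᴾ x = trans (eval-gadgetᴾ (ρ + ρ - 1ℚ) (ρ + ρ) c j p (∑ᴾ lit (allFin n)) x)
      (cong threshold (trans (eval-∑ᴾ x lit (allFin n))
        (trans (∑-cong (allFin n) (eval-lit x)) (∑-boolToℚ (holds x) (allFin n)))))

    andᴾ-true : ∀ x → all (holds x) (allFin n) ≡ true → eval andᴾ x ≡ 1ℚ
    andᴾ-true x all-true = trans (eval-andᴾ x)
      (trans (cong (λ m → threshold (fromℕ m))
               (trans (and⇒count≡length (map (holds x) (allFin n)) all-true) (length-map-allFin (holds x))))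
        threshold-hit)

    andᴾ-false : ∀ x → all (holds x) (allFin n) ≡ false → 0ℚ ≤ eval andᴾ x × eval andᴾ x ≤ ¼ ^ p
    andᴾ-false x not-all = subst (λ v → 0ℚ ≤ v × v ≤ ¼ ^ p) (sym (eval-andᴾ x))
      (threshold-miss _ (subst (count (map (holds x) (allFin n)) ℕ.<_) (length-map-allFin (holds x))
        (¬and⇒count<length (map (holds x) (allFin n)) not-all)))


module Sink where

  open Rationals
  open Polynomials
  open Counting
  import Data.Nat.Properties as ℕ
  open import Data.Rational using (1ℚ; _+_; _*_; _-_; _≤_; _/_)
  open import Data.Rational.Properties using (≤ᵇ⇒≤)
  open import Data.Integer using (+_)
  open import Data.Bool using (Bool; true; false; not)
  open import Data.List using (allFin)
  open import Data.List.Membership.Propositional.Properties using (∈-allFin)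
  open import Data.Fin using (Fin; _<?_) renaming (_<_ to _<ᶠ_)
  import Data.Fin.Properties as Fin
  open import Data.Product using (_,_; proj₁; proj₂)
  open import Data.Empty using (⊥-elim)
  open import Relation.Nullary using (yes; no)
  open import Relation.Binary.Definitions using (tri<; tri≈; tri>)
  open import Relation.Binary.PropositionalEquality using (_≡_; sym; trans; cong; cong₂; subst)

  module _ {k : ℕ} (x : SinkVar k → Bool) where

    incoming-< : ∀ u v (u<v : u <ᶠ v) → incoming x u v ≡ x ((u , v) , u<v)
    incoming-< u v u<v with u <? v
    ... | yes u<v′ = cong (λ q → x ((u , v) , q)) (ℕ.<-irrelevant u<v′ u<v)
    ... | no  u≮v  = ⊥-elim (u≮v u<v)

    incoming-> : ∀ u v (v<u : v <ᶠ u) → incoming x u v ≡ not (x ((v , u) , v<u))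
    incoming-> u v v<u with u <? v | v <? u
    ... | yes u<v | _        = ⊥-elim (ℕ.<-asym u<v v<u)
    ... | no _    | yes v<u′ = cong (λ q → not (x ((v , u) , q))) (ℕ.<-irrelevant v<u′ v<u)
    ... | no _    | no  v≮u  = ⊥-elim (v≮u v<u)

    incoming-at-sink : ∀ u v → isSink x v ≡ true → incoming x u v ≡ true
    incoming-at-sink u v sink = all-elim (λ w → incoming x w v) (allFin k) sink (∈-allFin u)

    -- The edge between two distinct vertices cannot point into both.
    sink-unique : ∀ u v → isSink x u ≡ true → isSink x v ≡ true → u ≡ v
    sink-unique u v sink-u sink-v with Fin.<-cmp u v
    ... | tri≈ _ u≡v _ = u≡v
    ... | tri< u<v _ _ = ⊥-elim (b∧not-b (x ((u , v) , u<v))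
          (trans (sym (incoming-< u v u<v)) (incoming-at-sink u v sink-v))
          (trans (sym (incoming-> v u u<v)) (incoming-at-sink v u sink-u)))
    ... | tri> _ _ v<u = ⊥-elim (b∧not-b (x ((v , u) , v<u))
          (trans (sym (incoming-< v u v<u)) (incoming-at-sink v u sink-u))
          (trans (sym (incoming-> u v v<u)) (incoming-at-sink u v sink-v)))

  incomingᴾ : ∀ {k} → Fin k → Fin k → Poly (SinkVar k)
  incomingᴾ u v with u <? v | v <? u
  ... | yes u<v | _       = varᴾ ((u , v) , u<v)
  ... | no _    | yes v<u = constᴾ 1ℚ -ᴾ varᴾ ((v , u) , v<u)
  ... | no _    | no _    = constᴾ 1ℚ

  eval-incomingᴾ : ∀ {k} (x : SinkVar k → Bool) u v → eval (incomingᴾ u v) x ≡ boolToℚ (incoming x u v)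
  eval-incomingᴾ x u v with u <? v | v <? u
  ... | yes u<v | _       = eval-varᴾ x ((u , v) , u<v)
  ... | no _    | yes v<u = trans (eval--ᴾ x (constᴾ 1ℚ) (varᴾ ((v , u) , v<u)))
                              (trans (cong₂ _-_ (eval-constᴾ x 1ℚ) (eval-varᴾ x ((v , u) , v<u)))
                                (1-boolToℚ (x ((v , u) , v<u))))
  ... | no _    | no _    = eval-constᴾ x 1ℚ

  deg-incomingᴾ : ∀ {k} (u v : Fin k) → Deg≤ 1 (incomingᴾ u v)
  deg-incomingᴾ u v with u <? v | v <? u
  ... | yes u<v | _       = deg-varᴾ _
  ... | no _    | yes v<u = deg--ᴾ (deg-constᴾ 1ℚ) (deg-varᴾ _)
  ... | no _    | no _    = deg-constᴾ 1ℚ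

  sink-approx : ∀ k m p → 1 ℕ.≤ k → 1 ℕ.≤ m → k ℕ.≤ m ℕ.* m → fromℕ k * ¼ ^ p ≤ + 1 / 3 →
    ApproxDeg≤ (SINK k) (p ℕ.* (m ℕ.* 1 ℕ.+ m ℕ.* 1))
  sink-approx k (suc j) p 1≤k _ k≤J² kε≤⅓ = P , degree-≤ P (deg-∑ᴾ sinkᴾ (allFin k) deg-andᴾ) , approximates
    where
      open Threshold k j p 1≤k k≤J²
      module Vertex (v : Fin k) =
        And (λ u → incomingᴾ u v) (λ x u → incoming x u v) (λ x u → eval-incomingᴾ x u v) (λ u → deg-incomingᴾ u v)
      open Vertex using (deg-andᴾ; andᴾ-true; andᴾ-false) renaming (andᴾ to sinkᴾ)
      P : Poly (SinkVar k)
      P = ∑ᴾ sinkᴾ (allFin k)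
      approximates : Approximates P (SINK k)
      approximates x = sandwich⇒∣-∣≤
        (subst (boolToℚ (SINK k x) ≤_) (sym (eval-∑ᴾ x sinkᴾ (allFin k))) (proj₁ bounds))
        (subst (_≤ boolToℚ (SINK k x) + fromℕ k * ¼ ^ p) (sym (eval-∑ᴾ x sinkᴾ (allFin k))) (proj₂ bounds))
        kε≤⅓
        where
          bounds = ∑-approximates-any (isSink x) (λ v → eval (sinkᴾ v) x) (^-nonNeg p (≤ᵇ⇒≤ _))
                     (sink-unique x) (λ v → andᴾ-true v x) (λ v → andᴾ-false v x)


module RubinsteinPattern where

  open Counting
  import Data.Nat.Properties as ℕ
  open import Data.Nat using (_≡ᵇ_; _<ᵇ_)
  open import Data.Nat.ListAction using (sum)
  open import Data.Bool using (Bool; true; false; not; _∧_; _∨_; if_then_else_)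
  open import Data.Bool.Properties using (T-≡; ∨-zeroʳ)
  open import Data.Bool.ListAction using (all; any)
  open import Data.List using (List; []; _∷_; allFin; tabulate)
  open import Data.List.Properties using (map-tabulate)
  open import Function.Bundles using (Equivalence)
  open import Data.List.Membership.Propositional using (_∈_)
  open import Data.List.Membership.Propositional.Properties using (∈-allFin)
  open import Data.List.Relation.Unary.Any using (here; there)
  open import Data.Fin using (Fin; zero; suc; toℕ; fromℕ<)
  import Data.Fin.Properties as Fin
  open import Data.Product using (Σ; _×_; _,_; proj₁; proj₂)
  open import Data.Sum using (_⊎_; inj₁; inj₂)
  open import Data.Empty using (⊥-elim)
  open import Relation.Binary.PropositionalEquality
    using (_≡_; _≢_; refl; sym; trans; cong; subst)

  ≡ᵇ-sound : ∀ {m n} → (m ≡ᵇ n) ≡ true → m ≡ n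
  ≡ᵇ-sound {m} {n} eq = ℕ.≡ᵇ⇒≡ m n (Equivalence.from T-≡ eq)

  ≡ᵇ-refl : ∀ n → (n ≡ᵇ n) ≡ true
  ≡ᵇ-refl n = Equivalence.to T-≡ (ℕ.≡⇒≡ᵇ n n refl)

  ≡ᵇ-false : ∀ {m n} → (m ≡ᵇ n) ≡ false → m ≢ n
  ≡ᵇ-false {m} eq refl with () ← trans (sym eq) (≡ᵇ-refl m)

  ≢⇒≡ᵇ-false : ∀ {m n} → m ≢ n → (m ≡ᵇ n) ≡ false
  ≢⇒≡ᵇ-false {m} {n} m≢n with m ≡ᵇ n in eq
  ... | true  = ⊥-elim (m≢n (≡ᵇ-sound eq))
  ... | false = refl

  ∧-elimˡ : ∀ {a b} → a ∧ b ≡ true → a ≡ true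
  ∧-elimˡ {true} _ = refl

  ∧-elimʳ : ∀ {a b} → a ∧ b ≡ true → b ≡ true
  ∧-elimʳ {true} eq = eq

  ∧-intro : ∀ {a b} → a ≡ true → b ≡ true → a ∧ b ≡ true
  ∧-intro refl refl = refl

  not-true : ∀ {b} → not b ≡ true → b ≡ false
  not-true {false} _ = refl

  any-intro : ∀ {A : Set} (f : A → Bool) l {a} → a ∈ l → f a ≡ true → any f l ≡ true
  any-intro f (b ∷ l) (here refl) fb rewrite fb = refl
  any-intro f (b ∷ l) (there a∈l) fa with f b
  ... | true  = refl
  ... | false = any-intro f l a∈l fa

  any-elim : ∀ {A : Set} (f : A → Bool) l → any f l ≡ true → Σ A λ a → f a ≡ true
  any-elim f (a ∷ l) eq with f a in fa
  ... | true  = a , fa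
  ... | false = any-elim f l eq

  all-intro : ∀ {A : Set} (f : A → Bool) l → (∀ a → f a ≡ true) → all f l ≡ true
  all-intro f []      _     = refl
  all-intro f (a ∷ l) all-f rewrite all-f a = all-intro f l all-f

  countᶠ : ∀ {n} → (Fin n → Bool) → ℕ
  countᶠ y = count (tabulate y)

  countOnes≡countᶠ : ∀ {n} (y : Fin n → Bool) → countOnes y ≡ countᶠ y
  countOnes≡countᶠ y = trans (cong sum (map-tabulate (λ i → i) (λ i → if y i then 1 else 0))) (go y)
    where
      go : ∀ {m} (y : Fin m → Bool) → sum (tabulate (λ i → if y i then 1 else 0)) ≡ countᶠ y
      go {ℕ.zero} y = refl
      go {suc m}  y with y zero
      ... | true  = cong suc (go (λ i → y (suc i)))
      ... | false = go (λ i → y (suc i))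

  clear : ∀ {n} → Fin n → (Fin n → Bool) → Fin n → Bool
  clear a y l = if toℕ l ≡ᵇ toℕ a then false else y l

  clear-other : ∀ {n} (a : Fin n) y l → toℕ l ≢ toℕ a → clear a y l ≡ y l
  clear-other a y l l≢a rewrite ≢⇒≡ᵇ-false l≢a = refl

  countᶠ-clear : ∀ {n} (y : Fin n → Bool) a → y a ≡ true → countᶠ y ≡ suc (countᶠ (clear a y))
  countᶠ-clear y zero    ya rewrite ya = refl
  countᶠ-clear y (suc a) ya with y zero
  ... | true  = cong suc (countᶠ-clear (λ l → y (suc l)) a ya)
  ... | false = countᶠ-clear (λ l → y (suc l)) a ya

  three-ones : ∀ {n} (y : Fin n → Bool) a b c → toℕ b ≢ toℕ a → toℕ c ≢ toℕ a → toℕ c ≢ toℕ b →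
    y a ≡ true → y b ≡ true → y c ≡ true → countᶠ y ≡ 3 ℕ.+ countᶠ (clear c (clear b (clear a y)))
  three-ones y a b c b≢a c≢a c≢b ya yb yc =
    trans (countᶠ-clear y a ya) (cong suc (trans
      (countᶠ-clear (clear a y) b (trans (clear-other a y b b≢a) yb)) (cong suc
      (countᶠ-clear (clear b (clear a y)) c (trans (clear-other b (clear a y) c c≢b) (trans (clear-other a y c c≢a) yc))))))

  module _ {k : ℕ} where

    inPair : Fin k → Fin k → Bool
    inPair j l = (toℕ l ≡ᵇ toℕ j) ∨ (toℕ l ≡ᵇ suc (toℕ j))

    -- matches y j: y is the indicator of {j, j + 1}, written as a conjunction of k literals
    agrees : (Fin k → Bool) → Fin k → Fin k → Bool
    agrees y j l = if inPair j l then y l else not (y l)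

    matches : (Fin k → Bool) → Fin k → Bool
    matches y j = all (agrees y j) (allFin k)

    inRange : Fin k → Bool
    inRange j = suc (toℕ j) <ᵇ k

    pairAt : (Fin k → Bool) → Fin k → Bool
    pairAt y j = inRange j ∧ matches y j

    inPair-self : ∀ j → inPair j j ≡ true
    inPair-self j rewrite ≡ᵇ-refl (toℕ j) = refl

    inPair-next : ∀ j j′ → toℕ j′ ≡ suc (toℕ j) → inPair j j′ ≡ true
    inPair-next j j′ eq rewrite eq | ≡ᵇ-refl (suc (toℕ j)) = ∨-zeroʳ (suc (toℕ j) ≡ᵇ toℕ j)

    inPair-sound : ∀ j l → inPair j l ≡ true → toℕ l ≡ toℕ j ⊎ toℕ l ≡ suc (toℕ j)
    inPair-sound j l eq with toℕ l ≡ᵇ toℕ j in l≡j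
    ... | true  = inj₁ (≡ᵇ-sound l≡j)
    ... | false = inj₂ (≡ᵇ-sound eq)

    inPair-false : ∀ j l → inPair j l ≡ false → toℕ l ≢ toℕ j × toℕ l ≢ suc (toℕ j)
    inPair-false j l eq with toℕ l ≡ᵇ toℕ j in l≡j
    ... | false = ≡ᵇ-false l≡j , ≡ᵇ-false eq

    matches⇒shape : ∀ {y j} → matches y j ≡ true → ∀ l → y l ≡ inPair j l
    matches⇒shape {y} {j} m l with inPair j l | all-elim (agrees y j) (allFin k) m (∈-allFin l)
    ... | true  | yl   = yl
    ... | false | ¬yl  = not-true ¬yl

    shape⇒matches : ∀ {y j} → (∀ l → y l ≡ inPair j l) → matches y j ≡ true
    shape⇒matches {y} {j} shape = all-intro (agrees y j) (allFin k) agree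
      where
        agree : ∀ l → agrees y j l ≡ true
        agree l with inPair j l | shape l
        ... | true  | yl = yl
        ... | false | yl rewrite yl = refl

    module _ (y : Fin k → Bool) where

      pairAt⇒g : ∀ j → pairAt y j ≡ true → g k y ≡ true
      pairAt⇒g j pair = ∧-intro (trans (cong (_≡ᵇ 2) (trans (countOnes≡countᶠ y) count≡2)) refl) adjacent
        where
          j+1<k : suc (toℕ j) ℕ.< k
          j+1<k = ℕ.<ᵇ⇒< _ _ (Equivalence.from T-≡ (∧-elimˡ pair))
          j′ : Fin k
          j′ = fromℕ< j+1<k
          j′≡j+1 : toℕ j′ ≡ suc (toℕ j)
          j′≡j+1 = Fin.toℕ-fromℕ< j+1<k
          shape = matches⇒shape (∧-elimʳ {inRange j} pair)
          yj : y j ≡ true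
          yj = trans (shape j) (inPair-self j)
          yj′ : y j′ ≡ true
          yj′ = trans (shape j′) (inPair-next j j′ j′≡j+1)
          j′≢j : toℕ j′ ≢ toℕ j
          j′≢j eq = ℕ.1+n≢n (trans (sym j′≡j+1) eq)
          rest-cleared : ∀ l → clear j′ (clear j y) l ≡ false
          rest-cleared l with toℕ l ≡ᵇ toℕ j′ in l≡j′
          ... | true  = refl
          ... | false with toℕ l ≡ᵇ toℕ j in l≡j
          ...   | true  = refl
          ...   | false = trans (shape l) (≢⇒inPair-false l (≡ᵇ-false l≡j) (λ eq → ≡ᵇ-false l≡j′ (trans eq (sym j′≡j+1))))
            where
              ≢⇒inPair-false : ∀ l → toℕ l ≢ toℕ j → toℕ l ≢ suc (toℕ j) → inPair j l ≡ false
              ≢⇒inPair-false l l≢j l≢j+1 rewrite ≢⇒≡ᵇ-false l≢j | ≢⇒≡ᵇ-false l≢j+1 = refl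
          count≡2 : countᶠ y ≡ 2
          count≡2 = trans (countᶠ-clear y j yj) (cong suc (trans
            (countᶠ-clear (clear j y) j′ (trans (clear-other j y j′ j′≢j) yj′))
            (cong suc (count-tabulate-false _ rest-cleared))))
          adjacent : any (λ i → any (λ i′ → (toℕ i′ ≡ᵇ suc (toℕ i)) ∧ y i ∧ y i′) (allFin k)) (allFin k) ≡ true
          adjacent = any-intro _ (allFin k) (∈-allFin j) (any-intro _ (allFin k) (∈-allFin j′)
            (∧-intro (trans (cong (_≡ᵇ suc (toℕ j)) j′≡j+1) (≡ᵇ-refl (suc (toℕ j)))) (∧-intro yj yj′)))

      adjacent-ones⇒shape : countᶠ y ≡ 2 → ∀ i i′ → toℕ i′ ≡ suc (toℕ i) → y i ≡ true → y i′ ≡ true →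
        ∀ l → y l ≡ inPair i l
      adjacent-ones⇒shape count≡2 i i′ i′≡i+1 yi yi′ l with inPair i l in l∈pair
      ... | true with inPair-sound i l l∈pair
      ...   | inj₁ l≡i   = subst (λ z → y z ≡ true) (sym (Fin.toℕ-injective l≡i)) yi
      ...   | inj₂ l≡i+1 = subst (λ z → y z ≡ true) (Fin.toℕ-injective (trans i′≡i+1 (sym l≡i+1))) yi′
      adjacent-ones⇒shape count≡2 i i′ i′≡i+1 yi yi′ l | false with y l in yl
      ...   | false = refl
      ...   | true  = ⊥-elim (3+m≢2 (trans (sym (three-ones y i i′ l i′≢i l≢i l≢i′ yi yi′ yl)) count≡2))
        where
          3+m≢2 : ∀ {m} → 3 ℕ.+ m ≢ 2
          3+m≢2 ()
          i′≢i : toℕ i′ ≢ toℕ i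
          i′≢i eq = ℕ.1+n≢n (trans (sym i′≡i+1) eq)
          l≢i : toℕ l ≢ toℕ i
          l≢i = proj₁ (inPair-false i l l∈pair)
          l≢i′ : toℕ l ≢ toℕ i′
          l≢i′ eq = proj₂ (inPair-false i l l∈pair) (trans eq i′≡i+1)

      g⇒pairAt : g k y ≡ true → Σ (Fin k) λ i → pairAt y i ≡ true
      g⇒pairAt gy = i , ∧-intro i+1<k
          (shape⇒matches (adjacent-ones⇒shape count≡2 i i′ i′≡i+1 (∧-elimˡ yi∧yi′) (∧-elimʳ {y i} yi∧yi′)))
        where
          count≡2 : countᶠ y ≡ 2
          count≡2 = trans (sym (countOnes≡countᶠ y)) (≡ᵇ-sound (∧-elimˡ gy))
          adjacent = any-elim _ (allFin k) (∧-elimʳ {countOnes y ≡ᵇ 2} gy)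
          i : Fin k
          i = proj₁ adjacent
          pair = any-elim _ (allFin k) (proj₂ adjacent)
          i′ : Fin k
          i′ = proj₁ pair
          i′≡i+1 : toℕ i′ ≡ suc (toℕ i)
          i′≡i+1 = ≡ᵇ-sound (∧-elimˡ (proj₂ pair))
          yi∧yi′ : y i ∧ y i′ ≡ true
          yi∧yi′ = ∧-elimʳ {toℕ i′ ≡ᵇ suc (toℕ i)} (proj₂ pair)
          i+1<k : inRange i ≡ true
          i+1<k = Equivalence.to T-≡ (ℕ.<⇒<ᵇ (subst (ℕ._< k) i′≡i+1 (Fin.toℕ<n i′)))

      pairAt-unique : ∀ i j → pairAt y i ≡ true → pairAt y j ≡ true → i ≡ j
      pairAt-unique i j pair-i pair-j =
        cases (inPair-sound j i (trans (sym (shape-j i)) (trans (shape-i i) (inPair-self i))))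
              (inPair-sound i j (trans (sym (shape-i j)) (trans (shape-j j) (inPair-self j))))
        where
          shape-i = matches⇒shape (∧-elimʳ {inRange i} pair-i)
          shape-j = matches⇒shape (∧-elimʳ {inRange j} pair-j)
          cases : toℕ i ≡ toℕ j ⊎ toℕ i ≡ suc (toℕ j) → toℕ j ≡ toℕ i ⊎ toℕ j ≡ suc (toℕ i) → i ≡ j
          cases (inj₁ i≡j)   _              = Fin.toℕ-injective i≡j
          cases (inj₂ _)     (inj₁ j≡i)     = sym (Fin.toℕ-injective j≡i)
          cases (inj₂ i≡j+1) (inj₂ j≡i+1)   = ⊥-elim (n≢2+n (trans i≡j+1 (cong suc j≡i+1)))
            where
              n≢2+n : ∀ {n} → n ≢ suc (suc n)
              n≢2+n {ℕ.zero} ()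
              n≢2+n {suc n}  eq = n≢2+n (ℕ.suc-injective eq)

      g≡any-pairAt : g k y ≡ any (pairAt y) (allFin k)
      g≡any-pairAt with any (pairAt y) (allFin k) in any-pair
      ... | true  = let (j , pair) = any-elim (pairAt y) (allFin k) any-pair in pairAt⇒g j pair
      ... | false with g k y in gy
      ...   | false = refl
      ...   | true  with () ← trans (sym any-pair)
                               (any-intro (pairAt y) (allFin k) (∈-allFin (proj₁ (g⇒pairAt gy))) (proj₂ (g⇒pairAt gy)))


module OrAmplifier (k M : ℕ) (1≤k : 1 ℕ.≤ k)
                   (J²≤k : suc M ℕ.* suc M ℕ.≤ k) (k≤4J² : k ℕ.≤ 4 ℕ.* (suc M ℕ.* suc M)) where

  open Rationals
  open Chebyshev
  open Gadget
  open import Data.Rational using (ℚ; 0ℚ; 1ℚ; _+_; _*_; _-_; -_; _≤_; _<_; _/_; *<*; ∣_∣; nonNegative)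
  open import Data.Rational.Properties
  open import Data.Integer using (+_; +<+)
  open import Data.Product using (_×_; _,_; proj₁; proj₂)
  open import Relation.Binary.PropositionalEquality using (_≡_; refl; sym; trans; cong; subst)
  open import Tactic.RingSolver using (solve-∀)

  K J : ℚ
  K = fromℕ k
  J = fromℕ (suc M)

  B≤K : J * J ≤ K
  B≤K = ≤-trans (≤-reflexive (sym (fromℕ-* (suc M) (suc M)))) (fromℕ-mono-≤ J²≤k)

  K≤4B : K ≤ + 4 / 1 * (J * J)
  K≤4B = ≤-trans (fromℕ-mono-≤ k≤4J²) (≤-reflexive (trans (fromℕ-* 4 (suc M ℕ.* suc M)) (cong (+ 4 / 1 *_) (fromℕ-* (suc M) (suc M)))))

  1/K r : ℚ
  1/K = reciprocal K (fromℕ-pos 1≤k)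
  r = + 1 / 32 * 1/K

  0≤r : 0ℚ ≤ r
  0≤r = *-nonNeg {+ 1 / 32} (≤ᵇ⇒≤ _) (reciprocal-nonNeg K (fromℕ-pos 1≤k))

  rK≡1/32 : r * K ≡ + 1 / 32
  rK≡1/32 = trans (*-assoc (+ 1 / 32) 1/K K)
    (trans (cong (+ 1 / 32 *_) (reciprocal-inverseˡ K (fromℕ-pos 1≤k))) (*-identityʳ (+ 1 / 32)))

  -- θ = r (M + 1)² lies in [1/128, 1/32]: it is the increment (M + 1)² δ at z = 0.
  θ : ℚ
  θ = r * (J * J)

  0≤θ : 0ℚ ≤ θ
  0≤θ = *-nonNeg 0≤r (0≤square J)

  θ≤1/32 : θ ≤ + 1 / 32
  θ≤1/32 = ≤-trans (*-monoˡ-≤-nonNeg r {{nonNegative 0≤r}} B≤K) (≤-reflexive rK≡1/32)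

  1/128≤θ : + 1 / 128 ≤ θ
  1/128≤θ = begin
      + 1 / 128                      ≡⟨ cong (_* (+ 1 / 4)) (sym rK≡1/32) ⟩
      r * K * (+ 1 / 4)              ≤⟨ *-monoʳ-≤-nonNeg (+ 1 / 4) (*-monoˡ-≤-nonNeg r {{nonNegative 0≤r}} K≤4B) ⟩
      r * (+ 4 / 1 * (J * J)) * (+ 1 / 4) ≡⟨ regroup r (J * J) ⟩
      θ                              ∎
    where
      open ≤-Reasoning
      regroup : ∀ r b → r * (+ 4 / 1 * b) * (+ 1 / 4) ≡ r * b
      regroup = solve-∀ ℚ-ring

  θ₋ : ℚ
  θ₋ = + 31 / 32 * θ

  0≤θ₋ : 0ℚ ≤ θ₋
  0≤θ₋ = *-nonNeg {+ 31 / 32} (≤ᵇ⇒≤ _) 0≤θ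

  w : ℚ
  w = (1ℚ + θ₋) * (1ℚ + θ₋)

  0<w : 0ℚ < w
  0<w = <-≤-trans (*<* (+<+ (ℕ.s≤s ℕ.z≤n))) (square-mono-≤ 0≤1 (p≤p+q 0≤θ₋))

  γ : ℚ
  γ = reciprocal w 0<w

  0≤γ : 0ℚ ≤ γ
  0≤γ = reciprocal-nonNeg w 0<w

  X : ℚ → ℚ
  X = gadget (1ℚ + r) (- r) γ M 80

  orGadget : ℚ → ℚ
  orGadget z = 1ℚ - + 2 / 3 * X z

  module NearZero {z : ℚ} (0≤z : 0ℚ ≤ z) (z≤1/32 : z ≤ + 1 / 32) where

    δ : ℚ
    δ = r * (1ℚ - z)

    0≤δ : 0ℚ ≤ δ
    0≤δ = *-nonNeg 0≤r (0≤-difference {b = 1ℚ} (≤-trans z≤1/32 (≤ᵇ⇒≤ _)))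

    J²δ≡ : J * J * δ ≡ θ * (1ℚ - z)
    J²δ≡ = regroup (J * J) r z
      where
        regroup : ∀ b r z → b * (r * (1ℚ - z)) ≡ r * b * (1ℚ - z)
        regroup = solve-∀ ℚ-ring

    θ₋≤J²δ : θ₋ ≤ J * J * δ
    θ₋≤J²δ = begin
      θ₋                ≡⟨ *-comm (+ 31 / 32) θ ⟩
      θ * (+ 31 / 32)   ≤⟨ *-monoˡ-≤-nonNeg θ {{nonNegative 0≤θ}} (≤-by-difference (+ 1 / 32 - z) (0≤-difference z≤1/32) (shift z)) ⟩
      θ * (1ℚ - z)      ≡⟨ sym J²δ≡ ⟩
      J * J * δ         ∎
      where
        open ≤-Reasoning
        shift : ∀ z → 1ℚ - z - + 31 / 32 ≡ + 1 / 32 - z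
        shift = solve-∀ ℚ-ring

    J²δ≤θ : J * J * δ ≤ θ
    J²δ≤θ = begin
      J * J * δ         ≡⟨ J²δ≡ ⟩
      θ * (1ℚ - z)      ≤⟨ *-monoˡ-≤-nonNeg θ {{nonNegative 0≤θ}} (≤-by-difference z 0≤z (cancel z)) ⟩
      θ * 1ℚ            ≡⟨ *-identityʳ θ ⟩
      θ                 ∎
      where
        open ≤-Reasoning
        cancel : ∀ z → 1ℚ - (1ℚ - z) ≡ z
        cancel = solve-∀ ℚ-ring

    T : ℚ
    T = chebyshevT (1ℚ + δ) M

    η : ℚ
    η = θ * (+ 1 / 32) + θ * θ

    0≤η : 0ℚ ≤ η
    0≤η = +-nonNeg (*-nonNeg 0≤θ (≤ᵇ⇒≤ _)) (*-nonNeg 0≤θ 0≤θ)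

    T-bounds : (1ℚ + θ₋ ≤ T) × (T ≤ (1ℚ + θ₋) * (1ℚ + η))
    T-bounds = ≤-trans (+-monoʳ-≤ 1ℚ θ₋≤J²δ) (proj₁ (chebyshev-lower M 0≤δ)) , (begin
      T                                       ≤⟨ proj₁ (chebyshev-upper M 0≤δ (≤-trans J²δ≤θ (≤-trans θ≤1/32 (≤ᵇ⇒≤ _)))) ⟩
      1ℚ + J * J * δ + (J * J * δ) * (J * J * δ) ≤⟨ +-mono-≤ (+-monoʳ-≤ 1ℚ J²δ≤θ) (square-mono-≤ (*-nonNeg (0≤square J) 0≤δ) J²δ≤θ) ⟩
      1ℚ + θ + θ * θ                          ≤⟨ ≤-by-difference (θ₋ * η) (*-nonNeg 0≤θ₋ 0≤η) (expand θ) ⟩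
      (1ℚ + θ₋) * (1ℚ + η)                    ∎)
      where
        open ≤-Reasoning
        expand : ∀ t → (1ℚ + + 31 / 32 * t) * (1ℚ + (t * (+ 1 / 32) + t * t)) - (1ℚ + t + t * t)
                       ≡ + 31 / 32 * t * (t * (+ 1 / 32) + t * t)
        expand = solve-∀ ℚ-ring

    X≡ : X z ≡ (γ * (T * T)) ^ 80
    X≡ = cong (λ x → (γ * (chebyshevT x M * chebyshevT x M)) ^ 80) (affine r z)
      where
        affine : ∀ r z → (1ℚ + r) + (- r) * z ≡ 1ℚ + r * (1ℚ - z)
        affine = solve-∀ ℚ-ring

    η₂ : ℚ
    η₂ = η + η + η * η

    0≤η₂ : 0ℚ ≤ η₂
    0≤η₂ = +-nonNeg (+-nonNeg 0≤η 0≤η) (*-nonNeg 0≤η 0≤η)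

    1≤γT² : 1ℚ ≤ γ * (T * T)
    1≤γT² = ≤-trans (≤-reflexive (sym (reciprocal-inverseˡ w 0<w)))
              (*-monoˡ-≤-nonNeg γ {{nonNegative 0≤γ}} (square-mono-≤ (+-nonNeg 0≤1 0≤θ₋) (proj₁ T-bounds)))

    γT²≤1+η₂ : γ * (T * T) ≤ 1ℚ + η₂
    γT²≤1+η₂ = begin
      γ * (T * T)                                  ≤⟨ *-monoˡ-≤-nonNeg γ {{nonNegative 0≤γ}}
                                                        (square-mono-≤ (≤-trans (+-nonNeg 0≤1 0≤θ₋) (proj₁ T-bounds)) (proj₂ T-bounds)) ⟩
      γ * (((1ℚ + θ₋) * (1ℚ + η)) * ((1ℚ + θ₋) * (1ℚ + η))) ≡⟨ regroup γ θ₋ η ⟩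
      γ * w * (1ℚ + η₂)                            ≡⟨ cong (_* (1ℚ + η₂)) (reciprocal-inverseˡ w 0<w) ⟩
      1ℚ * (1ℚ + η₂)                               ≡⟨ *-identityˡ (1ℚ + η₂) ⟩
      1ℚ + η₂                                      ∎
      where
        open ≤-Reasoning
        regroup : ∀ g t e → g * (((1ℚ + t) * (1ℚ + e)) * ((1ℚ + t) * (1ℚ + e)))
                            ≡ g * ((1ℚ + t) * (1ℚ + t)) * (1ℚ + (e + e + e * e))
        regroup = solve-∀ ℚ-ring

    [1+η₂]⁸⁰≤2 : (1ℚ + η₂) ^ 80 ≤ + 2 / 1
    [1+η₂]⁸⁰≤2 = begin
      (1ℚ + η₂) ^ 80                          ≡⟨ sym (*-identityʳ _) ⟩
      (1ℚ + η₂) ^ 80 * 1ℚ                     ≡⟨ *-assoc ((1ℚ + η₂) ^ 80) (+ 1 / 2) (+ 2 / 1) ⟨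
      (1ℚ + η₂) ^ 80 * (+ 1 / 2) * (+ 2 / 1)    ≤⟨ *-monoʳ-≤-nonNeg (+ 2 / 1)
                                                   (*-monoˡ-≤-nonNeg ((1ℚ + η₂) ^ 80) {{nonNegative (^-nonNeg 80 (+-nonNeg 0≤1 0≤η₂))}} ½≤1-80η₂) ⟩
      (1ℚ + η₂) ^ 80 * (1ℚ - fromℕ 80 * η₂) * (+ 2 / 1) ≤⟨ *-monoʳ-≤-nonNeg (+ 2 / 1) (bernoulli-reverse 80 0≤η₂) ⟩
      1ℚ * (+ 2 / 1)                          ≡⟨ *-identityˡ (+ 2 / 1) ⟩
      + 2 / 1                                 ∎
      where
        open ≤-Reasoning
        η≤ : η ≤ + 1 / 512
        η≤ = +-mono-≤ (*-monoʳ-≤-nonNeg (+ 1 / 32) θ≤1/32) (square-mono-≤ 0≤θ θ≤1/32)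
        80η₂≤½ : fromℕ 80 * η₂ ≤ + 1 / 2
        80η₂≤½ = ≤-trans (*-monoˡ-≤-nonNeg (fromℕ 80) {{nonNegative (fromℕ-nonNeg 80)}}
                   (+-mono-≤ (+-mono-≤ η≤ η≤) (square-mono-≤ 0≤η η≤))) (≤ᵇ⇒≤ _)
        ½≤1-80η₂ : + 1 / 2 ≤ 1ℚ - fromℕ 80 * η₂
        ½≤1-80η₂ = ≤-by-difference (+ 1 / 2 - fromℕ 80 * η₂) (0≤-difference 80η₂≤½) (shift (fromℕ 80 * η₂))
          where
            shift : ∀ v → 1ℚ - v - + 1 / 2 ≡ + 1 / 2 - v
            shift = solve-∀ ℚ-ring

    X-bounds : (1ℚ ≤ X z) × (X z ≤ + 2 / 1)
    X-bounds = subst (1ℚ ≤_) (sym X≡) (subst (_≤ (γ * (T * T)) ^ 80) (1^n≡1 80) (^-monoˡ-≤ 80 0≤1 1≤γT²))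
             , subst (_≤ + 2 / 1) (sym X≡) (≤-trans (^-monoˡ-≤ 80 (≤-trans 0≤1 1≤γT²) γT²≤1+η₂) [1+η₂]⁸⁰≤2)

  orGadget-near-0 : ∀ {z} → 0ℚ ≤ z → z ≤ + 1 / 32 → ∣ orGadget z - 0ℚ ∣ ≤ + 1 / 3
  orGadget-near-0 {z} 0≤z z≤1/32 = ∣∣-≤
    (≤-by-difference (+ 2 / 3 * (+ 2 / 1 - X z)) (*-nonNeg {+ 2 / 3} (≤ᵇ⇒≤ _) (0≤-difference (proj₂ X-bounds))) (lower (X z)))
    (≤-by-difference (+ 2 / 3 * (X z - 1ℚ)) (*-nonNeg {+ 2 / 3} (≤ᵇ⇒≤ _) (0≤-difference (proj₁ X-bounds))) (upper (X z)))
    where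
      open NearZero 0≤z z≤1/32 using (X-bounds)
      lower : ∀ x → (1ℚ - + 2 / 3 * x) - 0ℚ - - (+ 1 / 3) ≡ + 2 / 3 * (+ 2 / 1 - x)
      lower = solve-∀ ℚ-ring
      upper : ∀ x → + 1 / 3 - ((1ℚ - + 2 / 3 * x) - 0ℚ) ≡ + 2 / 3 * (x - 1ℚ)
      upper = solve-∀ ℚ-ring

  γ⁸⁰≤½ : γ ^ 80 ≤ + 1 / 2
  γ⁸⁰≤½ = inverse-antitone (^-nonNeg 80 0≤γ)
    (trans (sym (^-distrib-* γ w 80)) (trans (cong (_^ 80) (reciprocal-inverseˡ w 0<w)) (1^n≡1 80)))
    2≤w⁸⁰ (≤ᵇ⇒≤ _) refl
    where
      v : ℚ
      v = θ₋ + θ₋ + θ₋ * θ₋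
      0≤v : 0ℚ ≤ v
      0≤v = +-nonNeg (+-nonNeg 0≤θ₋ 0≤θ₋) (*-nonNeg 0≤θ₋ 0≤θ₋)
      θ₋≥ : + 31 / 32 * (+ 1 / 128) ≤ θ₋
      θ₋≥ = *-monoˡ-≤-nonNeg (+ 31 / 32) 1/128≤θ
      1≤80v : 1ℚ ≤ fromℕ 80 * v
      1≤80v = ≤-trans (≤ᵇ⇒≤ _) (*-monoˡ-≤-nonNeg (fromℕ 80) {{nonNegative (fromℕ-nonNeg 80)}}
                (+-mono-≤ (+-mono-≤ θ₋≥ θ₋≥) (square-mono-≤ (≤ᵇ⇒≤ _) θ₋≥)))
      expand : ∀ t → 1ℚ + (t + t + t * t) ≡ (1ℚ + t) * (1ℚ + t)
      expand = solve-∀ ℚ-ring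
      2≤w⁸⁰ : + 2 / 1 ≤ w ^ 80
      2≤w⁸⁰ = ≤-trans (+-monoʳ-≤ 1ℚ 1≤80v) (≤-trans (bernoulli 80 0≤v) (≤-reflexive (cong (_^ 80) (expand θ₋))))

  orGadget-far : ∀ {z} → 1ℚ ≤ z → z ≤ K + 1ℚ → ∣ orGadget z - 1ℚ ∣ ≤ + 1 / 3
  orGadget-far {z} 1≤z z≤K+1 = ∣∣-≤
    (≤-by-difference (+ 2 / 3 * (+ 1 / 2 - X z)) (*-nonNeg {+ 2 / 3} (≤ᵇ⇒≤ _) (0≤-difference X≤½)) (lower (X z)))
    (≤-by-difference (+ 1 / 3 + + 2 / 3 * X z) (+-nonNeg {+ 1 / 3} (≤ᵇ⇒≤ _) (*-nonNeg {+ 2 / 3} (≤ᵇ⇒≤ _) 0≤X)) (upper (X z)))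
    where
      x : ℚ
      x = (1ℚ + r) + (- r) * z
      r[z-1]≤1/32 : r * (z - 1ℚ) ≤ + 1 / 32
      r[z-1]≤1/32 = ≤-trans (*-monoˡ-≤-nonNeg r {{nonNegative 0≤r}}
                      (≤-by-difference (K + 1ℚ - z) (0≤-difference z≤K+1) (shift z K))) (≤-reflexive rK≡1/32)
        where
          shift : ∀ z K → K - (z - 1ℚ) ≡ K + 1ℚ - z
          shift = solve-∀ ℚ-ring
      -1≤x : - 1ℚ ≤ x
      -1≤x = ≤-by-difference (+ 1 / 32 - r * (z - 1ℚ) + (+ 2 / 1 - + 1 / 32))
               (+-nonNeg (0≤-difference r[z-1]≤1/32) (≤ᵇ⇒≤ _)) (lower-x r z)
        where
          lower-x : ∀ r z → (1ℚ + r) + (- r) * z - - 1ℚ ≡ + 1 / 32 - r * (z - 1ℚ) + (+ 2 / 1 - + 1 / 32)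
          lower-x = solve-∀ ℚ-ring
      x≤1 : x ≤ 1ℚ
      x≤1 = ≤-by-difference (r * (z - 1ℚ)) (*-nonNeg 0≤r (0≤-difference 1≤z)) (upper-x r z)
        where
          upper-x : ∀ r z → 1ℚ - ((1ℚ + r) + (- r) * z) ≡ r * (z - 1ℚ)
          upper-x = solve-∀ ℚ-ring
      T : ℚ
      T = chebyshevT x M
      0≤γT² : 0ℚ ≤ γ * (T * T)
      0≤γT² = *-nonNeg 0≤γ (0≤square T)
      γT²≤γ : γ * (T * T) ≤ γ
      γT²≤γ = ≤-trans (*-monoˡ-≤-nonNeg γ {{nonNegative 0≤γ}} (chebyshevT²≤1 M -1≤x x≤1)) (≤-reflexive (*-identityʳ γ))
      0≤X : 0ℚ ≤ X z
      0≤X = ^-nonNeg 80 0≤γT²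
      X≤½ : X z ≤ + 1 / 2
      X≤½ = ≤-trans (^-monoˡ-≤ 80 0≤γT² γT²≤γ) γ⁸⁰≤½
      lower : ∀ x → (1ℚ - + 2 / 3 * x) - 1ℚ - - (+ 1 / 3) ≡ + 2 / 3 * (+ 1 / 2 - x)
      lower = solve-∀ ℚ-ring
      upper : ∀ x → + 1 / 3 - ((1ℚ - + 2 / 3 * x) - 1ℚ) ≡ + 1 / 3 + + 2 / 3 * x
      upper = solve-∀ ℚ-ring


module Rubinstein where

  open Rationals
  open Polynomials
  open Counting
  open Gadget
  open RubinsteinPattern
  open import Data.Rational using (ℚ; 0ℚ; 1ℚ; _+_; _*_; _-_; -_; _≤_; _/_; ∣_∣)
  open import Data.Rational.Properties
    using (≤-trans; ≤-reflexive; ≤ᵇ⇒≤; +-mono-≤; +-identityˡ; *-assoc; ≤-refl)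
  open import Data.Integer using (+_)
  open import Data.Bool using (Bool; true; false; _∧_; if_then_else_)
  open import Data.List using (map; allFin; length)
  open import Data.List.Properties using (length-tabulate)
  open import Data.Fin using (Fin)
  open import Data.Product using (_×_; _,_; proj₁; proj₂)
  open import Relation.Binary.PropositionalEquality using (_≡_; refl; sym; trans; cong; cong₂; subst; subst₂)

  module Literals (k : ℕ) where

    block : (Fin k × Fin k → Bool) → Fin k → Fin k → Bool
    block x i l = x (i , l)

    agreesᴾ : Fin k → Fin k → Fin k → Poly (Fin k × Fin k)
    agreesᴾ i j l = if inPair j l then varᴾ (i , l) else constᴾ 1ℚ -ᴾ varᴾ (i , l)

    eval-agreesᴾ : ∀ i j x l → eval (agreesᴾ i j l) x ≡ boolToℚ (agrees (block x i) j l)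
    eval-agreesᴾ i j x l with inPair j l
    ... | true  = eval-varᴾ x (i , l)
    ... | false = trans (eval--ᴾ x (constᴾ 1ℚ) (varᴾ (i , l)))
                    (trans (cong₂ _-_ (eval-constᴾ x 1ℚ) (eval-varᴾ x (i , l))) (1-boolToℚ (x (i , l))))

    deg-agreesᴾ : ∀ i j l → Deg≤ 1 (agreesᴾ i j l)
    deg-agreesᴾ i j l with inPair j l
    ... | true  = deg-varᴾ (i , l)
    ... | false = deg--ᴾ (deg-constᴾ 1ℚ) (deg-varᴾ (i , l))

  module Approximation (k j p M : ℕ) (1≤k : 1 ℕ.≤ k) (k≤J² : k ℕ.≤ suc j ℕ.* suc j)
                       (k²ε≤1/32 : fromℕ k * fromℕ k * ¼ ^ p ≤ + 1 / 32)
                       (J²≤k : suc M ℕ.* suc M ℕ.≤ k) (k≤4J² : k ℕ.≤ 4 ℕ.* (suc M ℕ.* suc M)) where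

    open Literals k
    open Threshold k j p 1≤k k≤J²
    open OrAmplifier k M 1≤k J²≤k k≤4J²

    module Pattern (i j : Fin k) =
      And (agreesᴾ i j) (λ x → agrees (block x i) j) (eval-agreesᴾ i j) (deg-agreesᴾ i j)
    open Pattern using (deg-andᴾ; andᴾ-true; andᴾ-false) renaming (andᴾ to matchesᴾ)

    pairᴾ : Fin k → Fin k → Poly (Fin k × Fin k)
    pairᴾ i j = guardᴾ (inRange j) (matchesᴾ i j)

    blockᴾ : Fin k → Poly (Fin k × Fin k)
    blockᴾ i = ∑ᴾ (pairᴾ i) (allFin k)

    Z R : Poly (Fin k × Fin k)
    Z = ∑ᴾ blockᴾ (allFin k)
    R = constᴾ 1ℚ -ᴾ scaleᴾ (+ 2 / 3) (gadgetᴾ (1ℚ + r) (- r) γ M 80 Z)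

    D : ℕ
    D = p ℕ.* (suc j ℕ.* 1 ℕ.+ suc j ℕ.* 1)

    ε : ℚ
    ε = ¼ ^ p

    0≤ε : 0ℚ ≤ ε
    0≤ε = ^-nonNeg p (≤ᵇ⇒≤ _)

    deg-pairᴾ : ∀ i j → Deg≤ D (pairᴾ i j)
    deg-pairᴾ i j = deg-guardᴾ (inRange j) (deg-andᴾ i j)

    deg-R : Deg≤ (80 ℕ.* (suc M ℕ.* D ℕ.+ suc M ℕ.* D)) R
    deg-R = deg--ᴾ (deg-constᴾ 1ℚ) (deg-scaleᴾ (+ 2 / 3) (deg-gadgetᴾ (1ℚ + r) (- r) γ M 80
              (deg-∑ᴾ blockᴾ (allFin k) (λ i → deg-∑ᴾ (pairᴾ i) (allFin k) (deg-pairᴾ i)))))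

    module _ (x : Fin k × Fin k → Bool) where

      guarded-hit : ∀ b c P → (c ≡ true → eval P x ≡ 1ℚ) → b ∧ c ≡ true → eval (guardᴾ b P) x ≡ 1ℚ
      guarded-hit true c P hit c≡true = hit c≡true

      guarded-miss : ∀ b c P → (c ≡ false → 0ℚ ≤ eval P x × eval P x ≤ ε) → b ∧ c ≡ false →
        0ℚ ≤ eval (guardᴾ b P) x × eval (guardᴾ b P) x ≤ ε
      guarded-miss true  c P miss c≡false = miss c≡false
      guarded-miss false c P _    _       = ≤-refl , 0≤ε

      pairᴾ-hit : ∀ i j → pairAt (block x i) j ≡ true → eval (pairᴾ i j) x ≡ 1ℚ
      pairᴾ-hit i j = guarded-hit (inRange j) (matches (block x i) j) (matchesᴾ i j) (andᴾ-true i j x)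

      pairᴾ-miss : ∀ i j → pairAt (block x i) j ≡ false → 0ℚ ≤ eval (pairᴾ i j) x × eval (pairᴾ i j) x ≤ ε
      pairᴾ-miss i j = guarded-miss (inRange j) (matches (block x i) j) (matchesᴾ i j) (andᴾ-false i j x)

      σ : Fin k → ℚ
      σ i = boolToℚ (g k (block x i))

      block-bounds : ∀ i → (σ i ≤ eval (blockᴾ i) x) × (eval (blockᴾ i) x ≤ σ i + fromℕ k * ε)
      block-bounds i =
        subst₂ (λ b v → (b ≤ v) × (v ≤ b + fromℕ k * ε))
          (cong boolToℚ (sym (g≡any-pairAt (block x i)))) (sym (eval-∑ᴾ x (pairᴾ i) (allFin k)))
          (∑-approximates-any (pairAt (block x i)) (λ j → eval (pairᴾ i j) x) 0≤ε
            (pairAt-unique (block x i)) (pairᴾ-hit i) (pairᴾ-miss i))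

      s : ℕ
      s = count (map (λ i → g k (block x i)) (allFin k))

      Z-bounds : (fromℕ s ≤ eval Z x) × (eval Z x ≤ fromℕ s + + 1 / 32)
      Z-bounds = subst₂ (λ t v → (t ≤ v) × (v ≤ t + + 1 / 32)) (∑-boolToℚ (λ i → g k (block x i)) (allFin k))
                   (sym (eval-∑ᴾ x blockᴾ (allFin k)))
        (proj₁ sandwich , ≤-trans (proj₂ sandwich) (+-mono-≤ (≤-refl {∑ σ (allFin k)}) k·kε≤1/32))
        where
          sandwich = ∑-sandwich (λ i → eval (blockᴾ i) x) σ (fromℕ k * ε)
                       (λ i → proj₁ (block-bounds i)) (λ i → proj₂ (block-bounds i)) (allFin k)
          k·kε≤1/32 : fromℕ (length (allFin k)) * (fromℕ k * ε) ≤ + 1 / 32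
          k·kε≤1/32 = subst (λ n → fromℕ n * (fromℕ k * ε) ≤ + 1 / 32) (sym (length-tabulate {n = k} (λ i → i)))
                        (subst (_≤ + 1 / 32) (*-assoc (fromℕ k) (fromℕ k) ε) k²ε≤1/32)

      eval-R : eval R x ≡ orGadget (eval Z x)
      eval-R = trans (eval--ᴾ x (constᴾ 1ℚ) (scaleᴾ (+ 2 / 3) G))
        (cong₂ _-_ (eval-constᴾ x 1ℚ)
          (trans (eval-scaleᴾ x (+ 2 / 3) G) (cong (+ 2 / 3 *_) (eval-gadgetᴾ (1ℚ + r) (- r) γ M 80 Z x))))
        where G = gadgetᴾ (1ℚ + r) (- r) γ M 80 Z

      orGadget-Z-close : ∀ b → RUB k x ≡ b → ∣ orGadget (eval Z x) - boolToℚ b ∣ ≤ + 1 / 3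
      orGadget-Z-close false rub = orGadget-near-0
        (subst (_≤ eval Z x) (cong fromℕ s≡0) (proj₁ Z-bounds))
        (≤-trans (proj₂ Z-bounds) (≤-reflexive (trans (cong (λ n → fromℕ n + + 1 / 32) s≡0) (+-identityˡ _))))
        where
          s≡0 : s ≡ 0
          s≡0 = ¬or⇒count≡0 (map (λ i → g k (block x i)) (allFin k)) rub
      orGadget-Z-close true rub = orGadget-far
        (≤-trans (fromℕ-mono-≤ (or⇒count≥1 (map (λ i → g k (block x i)) (allFin k)) rub)) (proj₁ Z-bounds))
        (≤-trans (proj₂ Z-bounds) (+-mono-≤ (fromℕ-mono-≤ s≤k) (≤ᵇ⇒≤ _)))
        where
          s≤k : s ℕ.≤ k
          s≤k = subst (s ℕ.≤_) (length-map-allFin (λ i → g k (block x i)))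
                  (count-≤-length (map (λ i → g k (block x i)) (allFin k)))

    approximates : Approximates R (RUB k)
    approximates x = subst (λ v → ∣ v - boolToℚ (RUB k x) ∣ ≤ + 1 / 3) (sym (eval-R x)) (orGadget-Z-close x (RUB k x) refl)

  rub-approx : ∀ k m p M′ → 1 ℕ.≤ k → 1 ℕ.≤ m → k ℕ.≤ m ℕ.* m → fromℕ k * fromℕ k * ¼ ^ p ≤ + 1 / 32 →
    1 ℕ.≤ M′ → M′ ℕ.* M′ ℕ.≤ k → k ℕ.≤ 4 ℕ.* (M′ ℕ.* M′) →
    ApproxDeg≤ (RUB k) (80 ℕ.* (M′ ℕ.* (p ℕ.* (m ℕ.* 1 ℕ.+ m ℕ.* 1)) ℕ.+ M′ ℕ.* (p ℕ.* (m ℕ.* 1 ℕ.+ m ℕ.* 1))))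
  rub-approx k (suc j) p (suc M) 1≤k _ k≤J² k²ε≤1/32 _ J²≤k k≤4J² = R , degree-≤ R deg-R , approximates
    where open Approximation k j p M 1≤k k≤J² k²ε≤1/32 J²≤k k≤4J²


open import Data.Nat using (zero; _≤_; _<_; _+_; _*_; _^_; z≤n; s≤s; _<?_)
open import Data.Nat.Properties
open import Data.Nat.Logarithm using (⌈log₂_⌉; ⌈log₂⌉-mono-≤; ⌈log₂2^n⌉≡n)
open import Data.Nat.Tactic.RingSolver using (solve-∀)
open import Data.Bool using (Bool)
open import Data.Product using (Σ; _×_; _,_; proj₁; proj₂)
open import Relation.Binary.PropositionalEquality using (_≡_; refl; sym; trans; cong; subst)
open import Relation.Nullary using (yes; no)

ApproxDeg≤-mono : ∀ {V : Set} {h : (V → Bool) → Bool} {d e} → d ≤ e → ApproxDeg≤ h d → ApproxDeg≤ h e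
ApproxDeg≤-mono d≤e (P , deg≤d , approximates) = P , ≤-trans deg≤d d≤e , approximates

base-4-window : ∀ n → Σ ℕ λ b → (4 ^ b ≤ suc n) × (suc n < 4 * 4 ^ b)
base-4-window zero = 0 , s≤s z≤n , s≤s (s≤s z≤n)
base-4-window (suc n) with base-4-window n
... | b , lo , hi with suc (suc n) <? 4 * 4 ^ b
...   | yes below = b , m≤n⇒m≤1+n lo , below
...   | no  ≮     = suc b , ≤-reflexive (sym n+2≡4ᵇ⁺¹) , subst (_< 4 * (4 * 4 ^ b)) (sym n+2≡4ᵇ⁺¹) (m<m+n _ 0<3·4ᵇ⁺¹)
  where
    n+2≡4ᵇ⁺¹ : suc (suc n) ≡ 4 * 4 ^ b
    n+2≡4ᵇ⁺¹ = ≤-antisym hi (≮⇒≥ ≮)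
    0<3·4ᵇ⁺¹ : 0 < 4 * 4 ^ b + (4 * 4 ^ b + (4 * 4 ^ b + 0))
    0<3·4ᵇ⁺¹ = ≤-trans (m^n>0 4 (suc b)) (m≤m+n _ _)

2ᵇ*2ᵇ≡4ᵇ : ∀ b → 2 ^ b * 2 ^ b ≡ 4 ^ b
2ᵇ*2ᵇ≡4ᵇ zero    = refl
2ᵇ*2ᵇ≡4ᵇ (suc b) = trans (regroup (2 ^ b)) (cong (4 *_) (2ᵇ*2ᵇ≡4ᵇ b))
  where
    regroup : ∀ x → (2 * x) * (2 * x) ≡ 4 * (x * x)
    regroup = solve-∀

⌈log₂4ᵇ⌉≡b+b : ∀ b → ⌈log₂ (4 ^ b) ⌉ ≡ b + b
⌈log₂4ᵇ⌉≡b+b b = trans (cong ⌈log₂_⌉ (trans (sym (2ᵇ*2ᵇ≡4ᵇ b)) (sym (^-distribˡ-+-* 2 b b)))) (⌈log₂2^n⌉≡n (b + b))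

-- Parameters for k = n + 1 with 4ᵇ ≤ k < 4ᵇ⁺¹: the inner degree m = 2ᵇ⁺¹ satisfies k ≤ m², the
-- outer degree M = 2ᵇ satisfies M² ≤ k ≤ 4M², and p = 2b + 5 makes k² 4⁻ᵖ ≤ 1/32.
module Parameters (n : ℕ) where

  import Data.Rational as ℚ
  import Data.Rational.Properties as ℚ
  open import Data.Integer using (+_)
  open Rationals using (fromℕ; fromℕ-*; ¼; ≤4^⇒*¼^≤) renaming (_^_ to _^ℚ_)

  k b M m p : ℕ
  k = suc n
  b = proj₁ (base-4-window n)
  M = 2 ^ b
  m = 2 * M
  p = b + b + 5

  4ᵇ≤k : 4 ^ b ≤ k
  4ᵇ≤k = proj₁ (proj₂ (base-4-window n))

  k≤4·4ᵇ : k ≤ 4 * 4 ^ b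
  k≤4·4ᵇ = <⇒≤ (proj₂ (proj₂ (base-4-window n)))

  M²≡4ᵇ : M * M ≡ 4 ^ b
  M²≡4ᵇ = 2ᵇ*2ᵇ≡4ᵇ b

  1≤M : 1 ≤ M
  1≤M = m^n>0 2 b

  1≤m : 1 ≤ m
  1≤m = ≤-trans 1≤M (m≤m+n M _)

  M²≤k : M * M ≤ k
  M²≤k = subst (_≤ k) (sym M²≡4ᵇ) 4ᵇ≤k

  k≤4M² : k ≤ 4 * (M * M)
  k≤4M² = subst (λ v → k ≤ 4 * v) (sym M²≡4ᵇ) k≤4·4ᵇ

  k≤m² : k ≤ m * m
  k≤m² = subst (k ≤_) (sym m²≡4M²) k≤4M²
    where
      m²≡4M² : m * m ≡ 4 * (M * M)
      m²≡4M² = lemma M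
        where
          lemma : ∀ x → (2 * x) * (2 * x) ≡ 4 * (x * x)
          lemma = solve-∀

  4ᵖ≡1024·4ᵇ·4ᵇ : 4 ^ p ≡ 1024 * (4 ^ b * 4 ^ b)
  4ᵖ≡1024·4ᵇ·4ᵇ = trans (^-distribˡ-+-* 4 (b + b) 5) (trans (cong (_* 1024) (^-distribˡ-+-* 4 b b)) (*-comm (4 ^ b * 4 ^ b) 1024))

  4ᵇ≤4ᵇ·4ᵇ : 4 ^ b ≤ 4 ^ b * 4 ^ b
  4ᵇ≤4ᵇ·4ᵇ = m≤m*n (4 ^ b) (4 ^ b) {{m^n≢0 4 b}}

  sink-error : fromℕ k ℚ.* ¼ ^ℚ p ℚ.≤ + 1 ℚ./ 3
  sink-error = ≤4^⇒*¼^≤ 3 k p 3k≤4ᵖ refl (ℚ.≤ᵇ⇒≤ _)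
    where
      open ≤-Reasoning
      3k≤4ᵖ : 3 * k ≤ 4 ^ p
      3k≤4ᵖ = begin
        3 * k                    ≤⟨ *-monoʳ-≤ 3 k≤4·4ᵇ ⟩
        3 * (4 * 4 ^ b)          ≡⟨ *-assoc 3 4 (4 ^ b) ⟨
        12 * 4 ^ b               ≤⟨ *-mono-≤ (≤ᵇ⇒≤ 12 1024 _) 4ᵇ≤4ᵇ·4ᵇ ⟩
        1024 * (4 ^ b * 4 ^ b)   ≡⟨ 4ᵖ≡1024·4ᵇ·4ᵇ ⟨
        4 ^ p                    ∎

  rub-error : fromℕ k ℚ.* fromℕ k ℚ.* ¼ ^ℚ p ℚ.≤ + 1 ℚ./ 32
  rub-error = subst (λ v → v ℚ.* ¼ ^ℚ p ℚ.≤ + 1 ℚ./ 32) (fromℕ-* k k) (≤4^⇒*¼^≤ 32 (k * k) p 32k²≤4ᵖ refl (ℚ.≤ᵇ⇒≤ _))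
    where
      open ≤-Reasoning
      32k²≤4ᵖ : 32 * (k * k) ≤ 4 ^ p
      32k²≤4ᵖ = begin
        32 * (k * k)                     ≤⟨ *-monoʳ-≤ 32 (*-mono-≤ k≤4·4ᵇ k≤4·4ᵇ) ⟩
        32 * ((4 * 4 ^ b) * (4 * 4 ^ b)) ≡⟨ regroup (4 ^ b) ⟩
        512 * (4 ^ b * 4 ^ b)            ≤⟨ *-monoˡ-≤ (4 ^ b * 4 ^ b) (≤ᵇ⇒≤ 512 1024 _) ⟩
        1024 * (4 ^ b * 4 ^ b)           ≡⟨ 4ᵖ≡1024·4ᵇ·4ᵇ ⟨
        4 ^ p                            ∎
        where
          regroup : ∀ x → 32 * ((4 * x) * (4 * x)) ≡ 512 * (x * x)
          regroup = solve-∀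

  module _ (1≤n : 1 ≤ n) where

    h : ℕ
    h = ⌈log₂ k ⌉

    p≤6h : p ≤ 6 * h
    p≤6h = ≤-trans (+-mono-≤ b+b≤h (*-monoʳ-≤ 5 1≤h)) (≤-reflexive (regroup h))
      where
        b+b≤h : b + b ≤ h
        b+b≤h = subst (_≤ h) (⌈log₂4ᵇ⌉≡b+b b) (⌈log₂⌉-mono-≤ 4ᵇ≤k)
        1≤h : 1 ≤ h
        1≤h = ⌈log₂⌉-mono-≤ {2} (s≤s 1≤n)
        regroup : ∀ a → a + 5 * a ≡ 6 * a
        regroup = solve-∀

    sink-degree : (p * (m * 1 + m * 1)) * (p * (m * 1 + m * 1)) ≤ 576 * k * (h ^ 2)
    sink-degree = begin
      (p * (m * 1 + m * 1)) * (p * (m * 1 + m * 1)) ≡⟨ regroup p M ⟩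
      16 * (M * M) * (p * p)                       ≡⟨ cong (λ v → 16 * v * (p * p)) M²≡4ᵇ ⟩
      16 * 4 ^ b * (p * p)                          ≤⟨ *-mono-≤ (*-monoʳ-≤ 16 4ᵇ≤k) (*-mono-≤ p≤6h p≤6h) ⟩
      16 * k * ((6 * h) * (6 * h))                  ≡⟨ regroup′ k h ⟩
      576 * k * (h ^ 2)                             ∎
      where
        open ≤-Reasoning
        regroup : ∀ a c → (a * (2 * c * 1 + 2 * c * 1)) * (a * (2 * c * 1 + 2 * c * 1)) ≡ 16 * (c * c) * (a * a)
        regroup = solve-∀
        regroup′ : ∀ a c → 16 * a * ((6 * c) * (6 * c)) ≡ 576 * a * (c * (c * 1))
        regroup′ = solve-∀

    rub-degree : 80 * (M * (p * (m * 1 + m * 1)) + M * (p * (m * 1 + m * 1))) ≤ 3840 * k * h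
    rub-degree = begin
      80 * (M * (p * (m * 1 + m * 1)) + M * (p * (m * 1 + m * 1))) ≡⟨ regroup M p ⟩
      640 * (M * M) * p                           ≡⟨ cong (λ v → 640 * v * p) M²≡4ᵇ ⟩
      640 * 4 ^ b * p                             ≤⟨ *-mono-≤ (*-monoʳ-≤ 640 4ᵇ≤k) p≤6h ⟩
      640 * k * (6 * h)                           ≡⟨ regroup′ k h ⟩
      3840 * k * h                                ∎
      where
        open ≤-Reasoning
        regroup : ∀ a c → 80 * (a * (c * (2 * a * 1 + 2 * a * 1)) + a * (c * (2 * a * 1 + 2 * a * 1))) ≡ 640 * (a * a) * c
        regroup = solve-∀
        regroup′ : ∀ a c → 640 * a * (6 * c) ≡ 3840 * a * c
        regroup′ = solve-∀

lemmaA7 : (Σ ℕ λ C → Σ ℕ λ k₀ → ∀ k → k₀ ≤ k →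
    Σ ℕ λ d → (d * d ≤ C * k * (⌈log₂ k ⌉ ^ 2)) × ApproxDeg≤ (SINK k) d)
    ×
    (Σ ℕ λ C → Σ ℕ λ k₀ → ∀ k → k₀ ≤ k →
    ApproxDeg≤ (RUB k) (C * k * ⌈log₂ k ⌉))
lemmaA7 = (576 , 2 , sink-bound) , (3840 , 2 , rub-bound)
  where
    sink-bound : ∀ k → 2 ≤ k → Σ ℕ λ d → (d * d ≤ 576 * k * (⌈log₂ k ⌉ ^ 2)) × ApproxDeg≤ (SINK k) d
    sink-bound (suc n) (s≤s 1≤n) =
      p * (m * 1 + m * 1) , sink-degree 1≤n , Sink.sink-approx k m p (s≤s z≤n) 1≤m k≤m² sink-error
      where open Parameters n
    rub-bound : ∀ k → 2 ≤ k → ApproxDeg≤ (RUB k) (3840 * k * ⌈log₂ k ⌉)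
    rub-bound (suc n) (s≤s 1≤n) =
      ApproxDeg≤-mono {h = RUB k} (rub-degree 1≤n) (Rubinstein.rub-approx k m p M (s≤s z≤n) 1≤m k≤m² rub-error 1≤M M²≤k k≤4M²)
      where open Parameters n
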